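{- Let $(A,+,\times)$ be a finite commutative unitary ring with $A\neq\{0_A\}$, and let $R\subset A$ be a submagma of $(A,+)$, i.e. a subset of $A$ closed under $+$. (i) There are only finitely many irreducible $\lambda$-quiddities over $R$. (ii) Let $\ell_A$ be the maximum size of an irreducible $\lambda$-quiddity over $A$. - If $\mathrm{car}(A)=2$, then $4\le \ell_A\le \frac{|SL_2(A)|}{|A|}+2$. - If $\mathrm{car}(A)\neq 2$, then $\max(4,\mathrm{car}(A))\le \ell_A\le \frac{|SL_2(A)|}{2|A|}+2$.
   Context: For a commutative unitary ring $A$ and $a_1,\dots,a_n\in A$, set $M_n(a_1,\ldots,a_n)=\begin{pmatrix} a_n & -1_A\\ 1_A & 0_A\end{pmatrix}\begin{pmatrix} a_{n-1} & -1_A\\ 1_A & 0_A\end{pmatrix}\cdots\begin{pmatrix} a_1 & -1_A\\ 1_A & 0_A\end{pmatrix}$. Let $R\subset A$. An $n$-tuple $(a_1,\dots,a_n)\in R^n$ ($n\ge1$) is a $\lambda$-quiddity over $R$ (of size $n$) if $M_n(a_1,\dots,a_n)=\epsilon\,\mathrm{Id}$ for some $\epsilon\in\{\pm1_A\}$. For $(a_1,\dots,a_n)\in R^n$ and $(b_1,\dots,b_m)\in R^m$, define $(a_1,\dots,a_n)\oplus(b_1,\dots,b_m)=(a_1+b_m,a_2,\dots,a_{n-1},a_n+b_1,b_2,\dots,b_{m-1})$. Write $(a_1,\dots,a_n)\sim(b_1,\dots,b_n)$ if $(b_1,\dots,b_n)$ is obtained from $(a_1,\dots,a_n)$ or from $(a_n,\dots,a_1)$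 by a cyclic rotation. A $\lambda$-quiddity $(c_1,\dots,c_n)$ over $R$ with $n\ge3$ is reducible if there exist a $\lambda$-quiddity $(b_1,\dots,b_l)$ over $R$ and $(a_1,\dots,a_m)\in R^m$ with $m\ge3$, $l\ge3$ and $(c_1,\dots,c_n)\sim(a_1,\dots,a_m)\oplus(b_1,\dots,b_l)$. A $\lambda$-quiddity is irreducible if it is not reducible; the size-2 solution $(0_A,0_A)$ is never considered irreducible. $\ell_R\in\mathbb{N}\cup\{+\infty\}$ denotes the maximum size of an irreducible $\lambda$-quiddity over $R$. $\mathrm{car}(A)$ denotes the characteristic of $A$. -}

module Defs where

open import Level using (Level; _⊔_)
open import Data.Nat as ℕ using (ℕ; zero; suc)
open import Data.Product using (Σ; ∃; ∃-syntax; _×_; _,_; proj₁)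
open import Data.Sum using (_⊎_)
open import Data.List using (List; []; _∷_; _++_; drop; take; reverse; length)
open import Data.List.Relation.Unary.All using (All)
open import Data.List.Relation.Binary.Pointwise using (Pointwise)
open import Relation.Nullary using (¬_)
open import Relation.Binary.Bundles using (Setoid)
import Relation.Binary.Construct.On as On
open import Data.Product.Relation.Binary.Pointwise.NonDependent using (_×ₛ_)
open import Algebra.Bundles using (CommutativeRing)

module Q {c ℓ} (A : CommutativeRing c ℓ) where
  open CommutativeRing A

  record Mat : Set c where
    constructor mat
    field
      m11 m12 m21 m22 : Carrier
  open Mat public

  _·_ : Mat → Mat → Mat
  mat a b c' d · mat e f g h =
    mat (a * e + b * g) (a * f + b * h) (c' * e + d * g) (c' * f + d * h)

  _≈M_ : Mat → Mat → Set ℓ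
  M ≈M N = (m11 M ≈ m11 N) × (m12 M ≈ m12 N) × (m21 M ≈ m21 N) × (m22 M ≈ m22 N)

  Id : Mat
  Id = mat 1# 0# 0# 1#

  -Id : Mat
  -Id = mat (- 1#) 0# 0# (- 1#)

  Mₐ : Carrier → Mat
  Mₐ a = mat a (- 1#) 1# 0#

  -- Mₙ(a₁,…,aₙ) = Mₐ(aₙ) · … · Mₐ(a₁)
  monodromyAcc : Mat → List Carrier → Mat
  monodromyAcc acc []       = acc
  monodromyAcc acc (a ∷ as) = monodromyAcc (Mₐ a · acc) as

  Mₙ : List Carrier → Mat
  Mₙ = monodromyAcc Id

  IsλQuiddity : ∀ {p} → (Carrier → Set p) → List Carrier → Set (p ⊔ c ⊔ ℓ)
  IsλQuiddity R as =
    (1 ℕ.≤ length as) × All R as × (Mₙ as ≈M Id ⊎ Mₙ as ≈M -Id)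

  -- helper functions for ⊕ (only meaningful on lists of length ≥ 2)
  lastOr : Carrier → List Carrier → Carrier
  lastOr d []       = d
  lastOr d (x ∷ xs) = lastOr x xs

  dropLast : List Carrier → List Carrier
  dropLast []           = []
  dropLast (x ∷ [])     = []
  dropLast (x ∷ y ∷ xs) = x ∷ dropLast (y ∷ xs)

  -- (a₁,…,aₙ) ⊕ (b₁,…,bₘ) = (a₁+bₘ, a₂,…,aₙ₋₁, aₙ+b₁, b₂,…,bₘ₋₁)
  _⊕_ : List Carrier → List Carrier → List Carrier
  []       ⊕ bs       = bs
  (a ∷ as) ⊕ []       = a ∷ as
  (a ∷ as) ⊕ (b ∷ bs) =
    (a + lastOr b bs) ∷ (dropLast as ++ ((lastOr a as + b) ∷ dropLast bs))

  _≈L_ : List Carrier → List Carrier → Set (c ⊔ ℓ)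
  _≈L_ = Pointwise _≈_

  rotate : ℕ → List Carrier → List Carrier
  rotate k xs = drop k xs ++ take k xs

  _∼_ : List Carrier → List Carrier → Set (c ⊔ ℓ)
  as ∼ bs = ∃[ k ] (rotate k as ≈L bs ⊎ rotate k (reverse as) ≈L bs)

  Reducible : ∀ {p} → (Carrier → Set p) → List Carrier → Set (p ⊔ c ⊔ ℓ)
  Reducible R cs =
    IsλQuiddity R cs × (3 ℕ.≤ length cs) ×
    ∃[ as ] ∃[ bs ] (IsλQuiddity R bs × All R as ×
                     (3 ℕ.≤ length as) × (3 ℕ.≤ length bs) × (cs ∼ (as ⊕ bs)))

  Irreducible : ∀ {p} → (Carrier → Set p) → List Carrier → Set (p ⊔ c ⊔ ℓ)
  Irreducible R cs =
    IsλQuiddity R cs × ¬ Reducible R cs × ¬ (cs ≈L (0# ∷ 0# ∷ []))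

  IsMaxIrreducibleSize : ∀ {p} → (Carrier → Set p) → ℕ → Set (p ⊔ c ⊔ ℓ)
  IsMaxIrreducibleSize R m =
    (∃[ q ] (Irreducible R q × length q ≡ m)) ×
    (∀ q → Irreducible R q → length q ℕ.≤ m)
    where open import Relation.Binary.PropositionalEquality using (_≡_)

  Whole : Carrier → Set
  Whole _ = Data.Unit.⊤
    where import Data.Unit

  natToA : ℕ → Carrier
  natToA zero    = 0#
  natToA (suc n) = 1# + natToA n

  IsCharacteristic : ℕ → Set ℓ
  IsCharacteristic k =
    (1 ℕ.≤ k) × (natToA k ≈ 0#) × (∀ m → 1 ℕ.≤ m → natToA m ≈ 0# → k ℕ.≤ m)

  SL₂Carrier : Set (c ⊔ ℓ)
  SL₂Carrier = Σ (Carrier × Carrier × Carrier × Carrier)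
                 (λ { (a , b , c' , d) → a * d - b * c' ≈ 1# })

  SL₂ : Setoid (c ⊔ ℓ) ℓ
  SL₂ = On.setoid {B = SL₂Carrier} (setoid ×ₛ (setoid ×ₛ (setoid ×ₛ setoid))) proj₁

module Submission where

-- (i) A nonempty additively closed subset R of a finite ring contains 0, since some multiple of any
-- of its elements vanishes.  In a λ-quiddity longer than 3·|A|⁴, two of the prefixes of lengths
-- 0, 3, 6, … have the same monodromy, so the block between them (of size ≥ 3) has monodromy Id;
-- writing the quiddity, up to rotation, as (0, rest, 0) ⊕ block shows that it is reducible.  Hence
-- irreducible λ-quiddities have bounded size, and there are finitely many of them up to ≈.
--
-- (ii) Over a finite ring, irreducibility is decidable, so a longest irreducible λ-quiddity exists.
-- (0,0,0,0) is irreducible, and so is (2,…,2) of length car(A) when car(A) ≥ 5; this gives the lower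
-- bounds.  For the upper bound, let q be irreducible of size m and Pᵢ the monodromy of its prefix
-- of length i.  The matrices (σ 0; t σ)·Pᵢ with i < m − 2, t ∈ A and σ = ±1 are pairwise distinct
-- elements of SL₂(A): a coincidence for i < j yields a block of q, followed by at least three more
-- entries, whose monodromy has top-left entry ±1, and such a block extends to a λ-quiddity that
-- splits off q.  When car(A) = 2 the two signs coincide, so only half as many matrices are available.

open import Algebra.Bundles using (CommutativeRing)
open import Data.Empty using (⊥-elim)
open import Data.Fin as Fin using (Fin; toℕ)
import Data.Fin.Properties as FinP
open import Data.Integer as ℤ using (ℤ; +_; -[1+_]; _⊖_)
import Data.Integer.Properties as ℤP
open import Data.List as List using (List; []; _∷_; _++_; length; take; drop; reverse; replicate)
open import Data.List.Extrema.Nat using (argmax; argmax-all; f[xs]≤f[argmax])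
open import Data.List.Membership.Propositional.Properties using (∈-allFin; ∈-upTo⁺)
import Data.List.Properties as LP
open import Data.List.Relation.Binary.Pointwise as PW using ([]; _∷_)
import Data.List.Relation.Binary.Pointwise.Properties as PWP
open import Data.List.Relation.Unary.All as All using (All; []; _∷_)
import Data.List.Relation.Unary.All.Properties as AllP
open import Data.List.Relation.Unary.Any as Any using (Any; here)
import Data.List.Relation.Unary.Any.Properties as AnyP
open import Data.Maybe using (Maybe; just; nothing)
open import Data.Nat as ℕ using (ℕ; zero; suc; _≤_; _<_; z≤n; s≤s)
import Data.Nat.Properties as ℕP
open import Data.Nat.Tactic.RingSolver using (solve-∀)
open import Data.Product as Product using (_×_; _,_; proj₁; proj₂; ∃; ∃-syntax)
open import Data.Product.Relation.Binary.Pointwise.NonDependent using (_×ₛ_)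
open import Data.Sum as Sum using (_⊎_; inj₁; inj₂)
open import Data.Unit using (tt)
open import Defs
open import Function.Bundles using (Inverse; Injection)
open import Function.Properties.Inverse using (Inverse⇒Injection)
open import Level using (Level)
open import Relation.Binary.Bundles using (Setoid)
import Relation.Binary.Construct.On as On
open import Relation.Binary.PropositionalEquality as P using (_≡_; _≢_)
import Relation.Binary.Reasoning.Setoid as SetoidReasoning
open import Relation.Nullary using (¬_; yes; no; Dec)
import Relation.Nullary.Decidable as Dec

module RingSolver {c ℓ} (A : CommutativeRing c ℓ) where
  open CommutativeRing A
  open import Algebra.Properties.Ring ring using (-‿involutive; -0#≈0#; -‿+-comm; -‿distribˡ-*; -‿distribʳ-*)
  open import Algebra.Solver.Ring.AlmostCommutativeRing using (_-Raw-AlmostCommutative⟶_; fromCommutativeRing)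
  open SetoidReasoning setoid

  -- The special clause for 1 makes the solver constants 1 and -1 evaluate to 1# and - 1# on the nose.
  ℕ→A : ℕ → Carrier
  ℕ→A zero          = 0#
  ℕ→A (suc zero)    = 1#
  ℕ→A (suc (suc n)) = 1# + ℕ→A (suc n)

  ℕ→A-suc : ∀ n → ℕ→A (suc n) ≈ 1# + ℕ→A n
  ℕ→A-suc zero    = sym (+-identityʳ 1#)
  ℕ→A-suc (suc n) = refl

  ℕ→A-+ : ∀ m n → ℕ→A (m ℕ.+ n) ≈ ℕ→A m + ℕ→A n
  ℕ→A-+ zero    n = sym (+-identityˡ _)
  ℕ→A-+ (suc m) n = begin
    ℕ→A (suc (m ℕ.+ n))   ≈⟨ ℕ→A-suc (m ℕ.+ n) ⟩
    1# + ℕ→A (m ℕ.+ n)    ≈⟨ +-congˡ (ℕ→A-+ m n) ⟩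
    1# + (ℕ→A m + ℕ→A n)  ≈⟨ +-assoc _ _ _ ⟨
    (1# + ℕ→A m) + ℕ→A n  ≈⟨ +-congʳ (ℕ→A-suc m) ⟨
    ℕ→A (suc m) + ℕ→A n   ∎

  ℕ→A-* : ∀ m n → ℕ→A (m ℕ.* n) ≈ ℕ→A m * ℕ→A n
  ℕ→A-* zero    n = sym (zeroˡ _)
  ℕ→A-* (suc m) n = begin
    ℕ→A (n ℕ.+ m ℕ.* n)         ≈⟨ ℕ→A-+ n (m ℕ.* n) ⟩
    ℕ→A n + ℕ→A (m ℕ.* n)       ≈⟨ +-cong (sym (*-identityˡ _)) (ℕ→A-* m n) ⟩
    1# * ℕ→A n + ℕ→A m * ℕ→A n  ≈⟨ distribʳ _ _ _ ⟨
    (1# + ℕ→A m) * ℕ→A n        ≈⟨ *-congʳ (ℕ→A-suc m) ⟨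
    ℕ→A (suc m) * ℕ→A n         ∎

  ℤ→A : ℤ → Carrier
  ℤ→A (+ n)    = ℕ→A n
  ℤ→A -[1+ n ] = - ℕ→A (suc n)

  ℤ→A-⊖ : ∀ m n → ℤ→A (m ⊖ n) ≈ ℕ→A m - ℕ→A n
  ℤ→A-⊖ m       zero    = sym (trans (+-congˡ -0#≈0#) (+-identityʳ _))
  ℤ→A-⊖ zero    (suc n) = sym (+-identityˡ _)
  ℤ→A-⊖ (suc m) (suc n) rewrite ℤP.[1+m]⊖[1+n]≡m⊖n m n = begin
    ℤ→A (m ⊖ n)                    ≈⟨ ℤ→A-⊖ m n ⟩
    ℕ→A m - ℕ→A n                  ≈⟨ +-identityˡ _ ⟨
    0# + (ℕ→A m - ℕ→A n)           ≈⟨ +-congʳ (-‿inverseʳ 1#) ⟨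
    (1# - 1#) + (ℕ→A m - ℕ→A n)    ≈⟨ +-assoc 1# (- 1#) _ ⟩
    1# + (- 1# + (ℕ→A m - ℕ→A n))  ≈⟨ +-congˡ (+-comm (- 1#) _) ⟩
    1# + ((ℕ→A m - ℕ→A n) - 1#)    ≈⟨ +-congˡ (+-assoc (ℕ→A m) _ _) ⟩
    1# + (ℕ→A m + (- ℕ→A n - 1#))  ≈⟨ +-assoc 1# (ℕ→A m) _ ⟨
    (1# + ℕ→A m) + (- ℕ→A n - 1#)  ≈⟨ +-congˡ (trans (+-comm _ _) (-‿+-comm 1# (ℕ→A n))) ⟩
    (1# + ℕ→A m) - (1# + ℕ→A n)    ≈⟨ +-cong (ℕ→A-suc m) (-‿cong (ℕ→A-suc n)) ⟨
    ℕ→A (suc m) - ℕ→A (suc n)      ∎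

  ℤ→A-neg : ∀ i → ℤ→A (ℤ.- i) ≈ - ℤ→A i
  ℤ→A-neg (+ zero)  = sym -0#≈0#
  ℤ→A-neg (+ suc n) = refl
  ℤ→A-neg -[1+ n ]  = sym (-‿involutive _)

  ℤ→A-+ : ∀ i j → ℤ→A (i ℤ.+ j) ≈ ℤ→A i + ℤ→A j
  ℤ→A-+ (+ m)    (+ n)    = ℕ→A-+ m n
  ℤ→A-+ (+ m)    -[1+ n ] = ℤ→A-⊖ m (suc n)
  ℤ→A-+ -[1+ m ] (+ n)    = trans (ℤ→A-⊖ n (suc m)) (+-comm _ _)
  ℤ→A-+ -[1+ m ] -[1+ n ] = begin
    - ℕ→A (suc (suc (m ℕ.+ n)))    ≡⟨ P.cong (λ k → - ℕ→A (suc k)) (ℕP.+-suc m n) ⟨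
    - ℕ→A (suc m ℕ.+ suc n)        ≈⟨ -‿cong (ℕ→A-+ (suc m) (suc n)) ⟩
    - (ℕ→A (suc m) + ℕ→A (suc n))  ≈⟨ -‿+-comm _ _ ⟨
    - ℕ→A (suc m) - ℕ→A (suc n)    ∎

  ℤ→A-*-+ : ∀ m j → ℤ→A (+ m ℤ.* j) ≈ ℕ→A m * ℤ→A j
  ℤ→A-*-+ m (+ n) rewrite P.sym (ℤP.pos-* m n) = ℕ→A-* m n
  ℤ→A-*-+ m -[1+ n ] = begin
    ℤ→A (+ m ℤ.* ℤ.- (+ suc n))  ≡⟨ P.cong ℤ→A (ℤP.neg-distribʳ-* (+ m) (+ suc n)) ⟨
    ℤ→A (ℤ.- (+ m ℤ.* + suc n))  ≈⟨ ℤ→A-neg (+ m ℤ.* + suc n) ⟩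
    - ℤ→A (+ m ℤ.* + suc n)      ≈⟨ -‿cong (ℤ→A-*-+ m (+ suc n)) ⟩
    - (ℕ→A m * ℕ→A (suc n))      ≈⟨ -‿distribʳ-* _ _ ⟩
    ℕ→A m * - ℕ→A (suc n)        ∎

  ℤ→A-* : ∀ i j → ℤ→A (i ℤ.* j) ≈ ℤ→A i * ℤ→A j
  ℤ→A-* (+ m)    j = ℤ→A-*-+ m j
  ℤ→A-* -[1+ m ] j = begin
    ℤ→A (ℤ.- (+ suc m) ℤ.* j)  ≡⟨ P.cong ℤ→A (ℤP.neg-distribˡ-* (+ suc m) j) ⟨
    ℤ→A (ℤ.- (+ suc m ℤ.* j))  ≈⟨ ℤ→A-neg (+ suc m ℤ.* j) ⟩
    - ℤ→A (+ suc m ℤ.* j)      ≈⟨ -‿cong (ℤ→A-*-+ (suc m) j) ⟩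
    - (ℕ→A (suc m) * ℤ→A j)    ≈⟨ -‿distribˡ-* _ _ ⟩
    - ℕ→A (suc m) * ℤ→A j      ∎

  ℤ→A-homomorphism : ℤ.+-*-rawRing -Raw-AlmostCommutative⟶ fromCommutativeRing A
  ℤ→A-homomorphism = record
    { ⟦_⟧ = ℤ→A ; +-homo = ℤ→A-+ ; *-homo = ℤ→A-* ; -‿homo = ℤ→A-neg ; 0-homo = refl ; 1-homo = refl }

  ℤ→A-≟ : ∀ i j → Maybe (ℤ→A i ≈ ℤ→A j)
  ℤ→A-≟ i j with i ℤ.≟ j
  ... | yes P.refl = just refl
  ... | no  _      = nothing

  open import Algebra.Solver.Ring ℤ.+-*-rawRing (fromCommutativeRing A) ℤ→A-homomorphism ℤ→A-≟ public
    using (solve; _:=_; con; _:+_; _:*_; :-_; _:-_)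

module Lists {a} {X : Set a} where

  ∷-∷ʳ-view : ∀ (xs : List X) → 2 ≤ length xs → ∃[ x ] ∃[ mid ] ∃[ y ] xs ≡ x ∷ mid ++ y ∷ []
  ∷-∷ʳ-view (x ∷ rest) 2≤xs with List.initLast rest | 2≤xs
  ... | []             | s≤s ()
  ... | mid List.∷ʳ′ y | _ = x , mid , y , P.refl

  length-∷-∷ʳ : ∀ (x : X) mid y → length (x ∷ mid ++ y ∷ []) ≡ suc (suc (length mid))
  length-∷-∷ʳ x mid y = P.cong suc (P.trans (LP.length-++ mid) (ℕP.+-comm (length mid) 1))

  3≤length-∷-∷ʳ : ∀ (x : X) mid y → 1 ≤ length mid → 3 ≤ length (x ∷ mid ++ y ∷ [])
  3≤length-∷-∷ʳ x mid y 1≤mid rewrite length-∷-∷ʳ x mid y = s≤s (s≤s 1≤mid)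

  1≤length-middle : ∀ (x : X) mid y → 3 ≤ length (x ∷ mid ++ y ∷ []) → 1 ≤ length mid
  1≤length-middle x mid y 3≤ rewrite length-∷-∷ʳ x mid y = ℕP.≤-pred (ℕP.≤-pred 3≤)

  slice : ℕ → ℕ → List X → List X
  slice i j xs = drop i (take j xs)

  take-slice : ∀ {i j} xs → i ≤ j → take j xs ≡ take i xs ++ slice i j xs
  take-slice {i} {j} xs i≤j = begin
    take j xs                                 ≡⟨ LP.take++drop≡id i (take j xs) ⟨
    take i (take j xs) ++ drop i (take j xs)  ≡⟨ P.cong (_++ slice i j xs) (LP.take-take i j xs) ⟩
    take (i ℕ.⊓ j) xs ++ slice i j xs         ≡⟨ P.cong (λ k → take k xs ++ slice i j xs) (ℕP.m≤n⇒m⊓n≡m i≤j) ⟩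
    take i xs ++ slice i j xs                 ∎
    where open P.≡-Reasoning

  take-slice-drop : ∀ {i j} xs → i ≤ j → xs ≡ take i xs ++ slice i j xs ++ drop j xs
  take-slice-drop {i} {j} xs i≤j = begin
    xs                                       ≡⟨ LP.take++drop≡id j xs ⟨
    take j xs ++ drop j xs                   ≡⟨ P.cong (_++ drop j xs) (take-slice xs i≤j) ⟩
    (take i xs ++ slice i j xs) ++ drop j xs ≡⟨ LP.++-assoc (take i xs) (slice i j xs) (drop j xs) ⟩
    take i xs ++ slice i j xs ++ drop j xs   ∎
    where open P.≡-Reasoning

  length-slice : ∀ i {j} xs → j ≤ length xs → length (slice i j xs) ≡ j ℕ.∸ i
  length-slice i {j} xs j≤xs =
    P.trans (LP.length-drop i (take j xs))
            (P.cong (ℕ._∸ i) (P.trans (LP.length-take j xs) (ℕP.m≤n⇒m⊓n≡m j≤xs)))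

  All-reverse : ∀ {p} {Pr : X → Set p} {xs} → All Pr xs → All Pr (reverse xs)
  All-reverse {xs = []}     []         = []
  All-reverse {xs = x ∷ xs} (px ∷ pxs) =
    P.subst (All _) (P.sym (LP.unfold-reverse x xs)) (AllP.++⁺ (All-reverse pxs) (px ∷ []))

module Counting where

  remQuot-injective : ∀ {a} b {k k′ : Fin (a ℕ.* b)} → Fin.remQuot {a} b k ≡ Fin.remQuot b k′ → k ≡ k′
  remQuot-injective {a} b {k} {k′} eq = begin
    k                                                  ≡⟨ FinP.combine-remQuot {a} b k ⟨
    Product.uncurry Fin.combine (Fin.remQuot {a} b k)  ≡⟨ P.cong (Product.uncurry Fin.combine) eq ⟩
    Product.uncurry Fin.combine (Fin.remQuot {a} b k′) ≡⟨ FinP.combine-remQuot {a} b k′ ⟩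
    k′                                                 ∎
    where open P.≡-Reasoning

  injective₂⇒*≤ : ∀ {a b s} (f : Fin a → Fin b → Fin s) →
    (∀ {i j i′ j′} → f i j ≡ f i′ j′ → i ≡ i′ × j ≡ j′) → a ℕ.* b ≤ s
  injective₂⇒*≤ {a} {b} f f-injective = FinP.injective⇒≤ {f = λ k → Product.uncurry f (Fin.remQuot {a} b k)}
    (λ eq → remQuot-injective {a} b (Product.uncurry (P.cong₂ _,_) (f-injective eq)))

  <∸2⇒+3≤ : ∀ {i} m → i < m ℕ.∸ 2 → i ℕ.+ 3 ≤ m
  <∸2⇒+3≤ {i} (suc (suc m)) i<m = P.subst (_≤ suc (suc m)) (ℕP.+-comm 3 i) (s≤s (s≤s i<m))

  ∸2*≤⇒*≤ : ∀ m b s → (m ℕ.∸ 2) ℕ.* b ≤ s → m ℕ.* b ≤ s ℕ.+ 2 ℕ.* b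
  ∸2*≤⇒*≤ m b s bound = begin
    m ℕ.* b                      ≤⟨ ℕP.*-monoˡ-≤ b (ℕP.m≤n+m∸n m 2) ⟩
    (2 ℕ.+ (m ℕ.∸ 2)) ℕ.* b      ≡⟨ ℕP.*-distribʳ-+ b 2 (m ℕ.∸ 2) ⟩
    2 ℕ.* b ℕ.+ (m ℕ.∸ 2) ℕ.* b  ≤⟨ ℕP.+-monoʳ-≤ (2 ℕ.* b) bound ⟩
    2 ℕ.* b ℕ.+ s                ≡⟨ ℕP.+-comm (2 ℕ.* b) s ⟩
    s ℕ.+ 2 ℕ.* b                ∎
    where open ℕP.≤-Reasoning

-- 2×2 matrices and monodromy

module Matrices {c ℓ} (A : CommutativeRing c ℓ) where
  open CommutativeRing A
  open import Algebra.Properties.Ring ring using (-‿involutive; -1*x≈-x)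
  open RingSolver A using (solve; _:=_; con; _:+_; _:*_; :-_; _:-_)
  open Q A
  open Lists

  entries : Mat → Carrier × Carrier × Carrier × Carrier
  entries (mat a b c' d) = a , b , c' , d

  Mat-setoid : Setoid c ℓ
  Mat-setoid = On.setoid (setoid ×ₛ (setoid ×ₛ (setoid ×ₛ setoid))) entries

  module ≈M = Setoid Mat-setoid
  module ≈M-Reasoning = SetoidReasoning Mat-setoid

  ·-cong : ∀ {X X′ Y Y′} → X ≈M X′ → Y ≈M Y′ → (X · Y) ≈M (X′ · Y′)
  ·-cong {mat _ _ _ _} {mat _ _ _ _} {mat _ _ _ _} {mat _ _ _ _} (a , b , c' , d) (e , f , g , h) =
    +-cong (*-cong a e) (*-cong b g) , +-cong (*-cong a f) (*-cong b h) ,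
    +-cong (*-cong c' e) (*-cong d g) , +-cong (*-cong c' f) (*-cong d h)

  ·-assoc : ∀ X Y Z → ((X · Y) · Z) ≈M (X · (Y · Z))
  ·-assoc (mat a b c' d) (mat e f g h) (mat i j k l) =
    entry a b e f g h i k , entry a b e f g h j l , entry c' d e f g h i k , entry c' d e f g h j l
    where
    entry : ∀ a b e f g h i k → (a * e + b * g) * i + (a * f + b * h) * k ≈ a * (e * i + f * k) + b * (g * i + h * k)
    entry = solve 8 (λ a b e f g h i k →
      (a :* e :+ b :* g) :* i :+ (a :* f :+ b :* h) :* k := a :* (e :* i :+ f :* k) :+ b :* (g :* i :+ h :* k)) refl

  private
    1x+0y≈x : ∀ x y → 1# * x + 0# * y ≈ x
    1x+0y≈x = solve 2 (λ x y → con (+ 1) :* x :+ con (+ 0) :* y := x) refl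

    0x+1y≈y : ∀ x y → 0# * x + 1# * y ≈ y
    0x+1y≈y = solve 2 (λ x y → con (+ 0) :* x :+ con (+ 1) :* y := y) refl

    x1+y0≈x : ∀ x y → x * 1# + y * 0# ≈ x
    x1+y0≈x = solve 2 (λ x y → x :* con (+ 1) :+ y :* con (+ 0) := x) refl

    x0+y1≈y : ∀ x y → x * 0# + y * 1# ≈ y
    x0+y1≈y = solve 2 (λ x y → x :* con (+ 0) :+ y :* con (+ 1) := y) refl

  ·-identityˡ : ∀ X → (Id · X) ≈M X
  ·-identityˡ (mat a b c' d) = 1x+0y≈x a c' , 1x+0y≈x b d , 0x+1y≈y a c' , 0x+1y≈y b d

  ·-identityʳ : ∀ X → (X · Id) ≈M X
  ·-identityʳ (mat a b c' d) = x1+y0≈x a b , x0+y1≈y a b , x1+y0≈x c' d , x0+y1≈y c' d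

  det : Mat → Carrier
  det (mat a b c' d) = a * d - b * c'

  det-cong : ∀ {X Y} → X ≈M Y → det X ≈ det Y
  det-cong {mat _ _ _ _} {mat _ _ _ _} (a , b , c' , d) = +-cong (*-cong a d) (-‿cong (*-cong b c'))

  det-· : ∀ X Y → det (X · Y) ≈ det X * det Y
  det-· (mat a b c' d) (mat e f g h) = solve 8 (λ a b c' d e f g h →
    (a :* e :+ b :* g) :* (c' :* f :+ d :* h) :- (a :* f :+ b :* h) :* (c' :* e :+ d :* g) :=
    (a :* d :- b :* c') :* (e :* h :- f :* g)) refl a b c' d e f g h

  det-Mₐ : ∀ x → det (Mₐ x) ≈ 1#
  det-Mₐ = solve 1 (λ x → x :* con (+ 0) :- (:- con (+ 1)) :* con (+ 1) := con (+ 1)) refl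

  adj : Mat → Mat
  adj (mat a b c' d) = mat d (- b) (- c') a

  ·-adj : ∀ X → det X ≈ 1# → (X · adj X) ≈M Id
  ·-adj (mat a b c' d) det≈1 =
    trans (solve 4 (λ a b c' d → a :* d :+ b :* (:- c') := a :* d :- b :* c') refl a b c' d) det≈1 ,
    solve 4 (λ a b c' d → a :* (:- b) :+ b :* a := con (+ 0)) refl a b c' d ,
    solve 4 (λ a b c' d → c' :* d :+ d :* (:- c') := con (+ 0)) refl a b c' d ,
    trans (solve 4 (λ a b c' d → c' :* (:- b) :+ d :* a := a :* d :- b :* c') refl a b c' d) det≈1

  ·-cancelʳ : ∀ {Z} X Y → det Z ≈ 1# → (X · Z) ≈M (Y · Z) → X ≈M Y
  ·-cancelʳ {Z} X Y det≈1 XZ≈YZ = begin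
    X                ≈⟨ ·-identityʳ X ⟨
    X · Id           ≈⟨ ·-cong ≈M.refl (·-adj Z det≈1) ⟨
    X · (Z · adj Z)  ≈⟨ ·-assoc X Z (adj Z) ⟨
    (X · Z) · adj Z  ≈⟨ ·-cong XZ≈YZ ≈M.refl ⟩
    (Y · Z) · adj Z  ≈⟨ ·-assoc Y Z (adj Z) ⟩
    Y · (Z · adj Z)  ≈⟨ ·-cong ≈M.refl (·-adj Z det≈1) ⟩
    Y · Id           ≈⟨ ·-identityʳ Y ⟩
    Y                ∎
    where open ≈M-Reasoning

  infix 4 _≈±1 _≈±Id

  _≈±1 : Carrier → Set ℓ
  x ≈±1 = x ≈ 1# ⊎ x ≈ - 1#

  _≈±Id : Mat → Set ℓ
  X ≈±Id = X ≈M Id ⊎ X ≈M -Id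

  -1*-1≈1 : - 1# * - 1# ≈ 1#
  -1*-1≈1 = trans (-1*x≈-x (- 1#)) (-‿involutive 1#)

  ≈±1-resp : ∀ {x y} → x ≈ y → x ≈±1 → y ≈±1
  ≈±1-resp x≈y = Sum.map (trans (sym x≈y)) (trans (sym x≈y))

  ≈±1-* : ∀ {x y} → x ≈±1 → y ≈±1 → x * y ≈±1
  ≈±1-* (inj₁ x≈1)  (inj₁ y≈1)  = inj₁ (trans (*-cong x≈1 y≈1) (*-identityˡ 1#))
  ≈±1-* (inj₁ x≈1)  (inj₂ y≈-1) = inj₂ (trans (*-cong x≈1 y≈-1) (*-identityˡ (- 1#)))
  ≈±1-* (inj₂ x≈-1) (inj₁ y≈1)  = inj₂ (trans (*-cong x≈-1 y≈1) (*-identityʳ (- 1#)))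
  ≈±1-* (inj₂ x≈-1) (inj₂ y≈-1) = inj₁ (trans (*-cong x≈-1 y≈-1) -1*-1≈1)

  ≈±1⇒x*x≈1 : ∀ {x} → x ≈±1 → x * x ≈ 1#
  ≈±1⇒x*x≈1 (inj₁ x≈1)  = trans (*-cong x≈1 x≈1) (*-identityˡ 1#)
  ≈±1⇒x*x≈1 (inj₂ x≈-1) = trans (*-cong x≈-1 x≈-1) -1*-1≈1

  lower : Carrier → Carrier → Mat
  lower σ t = mat σ 0# t σ

  det-lower : ∀ {σ} t → σ ≈±1 → det (lower σ t) ≈ 1#
  det-lower {σ} t σ≈±1 =
    trans (solve 2 (λ σ t → σ :* σ :- con (+ 0) :* t := σ :* σ) refl σ t) (≈±1⇒x*x≈1 σ≈±1)

  Mₐ-cong : ∀ {x y} → x ≈ y → Mₐ x ≈M Mₐ y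
  Mₐ-cong x≈y = x≈y , refl , refl , refl

  mutual
    monodromyAcc≈ : ∀ acc xs → monodromyAcc acc xs ≈M (Mₙ xs · acc)
    monodromyAcc≈ acc []       = ≈M.sym (·-identityˡ acc)
    monodromyAcc≈ acc (x ∷ xs) = begin
      monodromyAcc (Mₐ x · acc) xs  ≈⟨ monodromyAcc≈ (Mₐ x · acc) xs ⟩
      Mₙ xs · (Mₐ x · acc)          ≈⟨ ·-assoc (Mₙ xs) (Mₐ x) acc ⟨
      (Mₙ xs · Mₐ x) · acc          ≈⟨ ·-cong (Mₙ-∷ x xs) ≈M.refl ⟨
      Mₙ (x ∷ xs) · acc             ∎
      where open ≈M-Reasoning

    Mₙ-∷ : ∀ x xs → Mₙ (x ∷ xs) ≈M (Mₙ xs · Mₐ x)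
    Mₙ-∷ x xs = ≈M.trans (monodromyAcc≈ (Mₐ x · Id) xs) (·-cong ≈M.refl (·-identityʳ (Mₐ x)))

  Mₙ-++ : ∀ xs ys → Mₙ (xs ++ ys) ≈M (Mₙ ys · Mₙ xs)
  Mₙ-++ xs ys = ≈M.trans (≈M.reflexive (monodromyAcc-++ Id xs)) (monodromyAcc≈ (Mₙ xs) ys)
    where
    monodromyAcc-++ : ∀ acc xs → monodromyAcc acc (xs ++ ys) ≡ monodromyAcc (monodromyAcc acc xs) ys
    monodromyAcc-++ acc []       = P.refl
    monodromyAcc-++ acc (x ∷ xs) = monodromyAcc-++ (Mₐ x · acc) xs

  Mₙ-take-slice : ∀ {i j} xs → i ≤ j → Mₙ (take j xs) ≈M (Mₙ (slice i j xs) · Mₙ (take i xs))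
  Mₙ-take-slice {i} {j} xs i≤j =
    ≈M.trans (≈M.reflexive (P.cong Mₙ (take-slice xs i≤j))) (Mₙ-++ (take i xs) (slice i j xs))

  Mₙ-cong : ∀ {xs ys} → xs ≈L ys → Mₙ xs ≈M Mₙ ys
  Mₙ-cong []                               = ≈M.refl
  Mₙ-cong {x ∷ xs} {y ∷ ys} (x≈y ∷ xs≈ys) = begin
    Mₙ (x ∷ xs)   ≈⟨ Mₙ-∷ x xs ⟩
    Mₙ xs · Mₐ x  ≈⟨ ·-cong (Mₙ-cong xs≈ys) (Mₐ-cong x≈y) ⟩
    Mₙ ys · Mₐ y  ≈⟨ Mₙ-∷ y ys ⟨
    Mₙ (y ∷ ys)   ∎
    where open ≈M-Reasoning

  det-Mₙ : ∀ xs → det (Mₙ xs) ≈ 1#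
  det-Mₙ []       = solve 0 (con (+ 1) :* con (+ 1) :- con (+ 0) :* con (+ 0) := con (+ 1)) refl
  det-Mₙ (x ∷ xs) = begin
    det (Mₙ (x ∷ xs))         ≈⟨ det-cong (Mₙ-∷ x xs) ⟩
    det (Mₙ xs · Mₐ x)        ≈⟨ det-· (Mₙ xs) (Mₐ x) ⟩
    det (Mₙ xs) * det (Mₐ x)  ≈⟨ *-cong (det-Mₙ xs) (det-Mₐ x) ⟩
    1# * 1#                   ≈⟨ *-identityˡ 1# ⟩
    1#                        ∎
    where open SetoidReasoning setoid

  Mₙ-∷-∷ʳ : ∀ y mid x → Mₙ (y ∷ mid ++ x ∷ []) ≈M (Mₐ x · (Mₙ mid · Mₐ y))
  Mₙ-∷-∷ʳ y mid x = begin
    Mₙ (y ∷ mid ++ x ∷ [])         ≈⟨ Mₙ-∷ y (mid ++ x ∷ []) ⟩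
    Mₙ (mid ++ x ∷ []) · Mₐ y      ≈⟨ ·-cong (Mₙ-++ mid (x ∷ [])) ≈M.refl ⟩
    (Mₙ (x ∷ []) · Mₙ mid) · Mₐ y  ≈⟨ ·-cong (·-cong (Mₙ-∷ x []) ≈M.refl) ≈M.refl ⟩
    ((Id · Mₐ x) · Mₙ mid) · Mₐ y  ≈⟨ ·-cong (·-cong (·-identityˡ (Mₐ x)) ≈M.refl) ≈M.refl ⟩
    (Mₐ x · Mₙ mid) · Mₐ y         ≈⟨ ·-assoc (Mₐ x) (Mₙ mid) (Mₐ y) ⟩
    Mₐ x · (Mₙ mid · Mₐ y)         ∎
    where open ≈M-Reasoning

  sandwich≈ : ∀ x y a b c' d →
    (Mₐ x · (mat a b c' d · Mₐ y)) ≈M mat (x * (a * y + b) - (c' * y + d)) (c' - x * a) (a * y + b) (- a)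
  sandwich≈ x y a b c' d =
    solve 6 (λ x y a b c' d →
      x :* (a :* y :+ b :* con (+ 1)) :+ (:- con (+ 1)) :* (c' :* y :+ d :* con (+ 1))
        := x :* (a :* y :+ b) :- (c' :* y :+ d)) refl x y a b c' d ,
    solve 6 (λ x y a b c' d →
      x :* (a :* (:- con (+ 1)) :+ b :* con (+ 0)) :+ (:- con (+ 1)) :* (c' :* (:- con (+ 1)) :+ d :* con (+ 0))
        := c' :- x :* a) refl x y a b c' d ,
    solve 6 (λ x y a b c' d →
      con (+ 1) :* (a :* y :+ b :* con (+ 1)) :+ con (+ 0) :* (c' :* y :+ d :* con (+ 1))
        := a :* y :+ b) refl x y a b c' d ,
    solve 6 (λ x y a b c' d →
      con (+ 1) :* (a :* (:- con (+ 1)) :+ b :* con (+ 0)) :+ con (+ 0) :* (c' :* (:- con (+ 1)) :+ d :* con (+ 0))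
        := :- a) refl x y a b c' d

  m11-middle≈-m22 : ∀ {Y} y mid x → Mₙ (y ∷ mid ++ x ∷ []) ≈M Y → m11 (Mₙ mid) ≈ - m22 Y
  m11-middle≈-m22 {Y} y mid x M≈Y = begin
    m11 (Mₙ mid)                    ≈⟨ -‿involutive _ ⟨
    - - m11 (Mₙ mid)                ≈⟨ -‿cong (m22≈ (sandwich≈ x y _ _ _ _)) ⟨
    - m22 (Mₐ x · (Mₙ mid · Mₐ y))  ≈⟨ -‿cong (m22≈ (Mₙ-∷-∷ʳ y mid x)) ⟨
    - m22 (Mₙ (y ∷ mid ++ x ∷ []))  ≈⟨ -‿cong (m22≈ M≈Y) ⟩
    - m22 Y                         ∎
    where
    open SetoidReasoning setoid
    m22≈ : ∀ {X Y} → X ≈M Y → m22 X ≈ m22 Y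
    m22≈ (_ , _ , _ , e) = e

  extendable⇒m11≈±1 : ∀ y mid x → Mₙ (y ∷ mid ++ x ∷ []) ≈±Id → m11 (Mₙ mid) ≈±1
  extendable⇒m11≈±1 y mid x (inj₁ M≈Id)  = inj₂ (m11-middle≈-m22 y mid x M≈Id)
  extendable⇒m11≈±1 y mid x (inj₂ M≈-Id) = inj₁ (trans (m11-middle≈-m22 y mid x M≈-Id) (-‿involutive 1#))

  det≈1⇒m22≈ : ∀ {σ} X → det X ≈ 1# → m11 X ≈ σ → σ ≈±1 → m22 X ≈ σ * (1# + m12 X * m21 X)
  det≈1⇒m22≈ {σ} (mat a b c' d) det≈1 a≈σ σ≈±1 = begin
    d                                ≈⟨ *-identityˡ d ⟨
    1# * d                           ≈⟨ *-congʳ (≈±1⇒x*x≈1 σ≈±1) ⟨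
    (σ * σ) * d                      ≈⟨ *-assoc σ σ d ⟩
    σ * (σ * d)                      ≈⟨ *-congˡ (*-congʳ a≈σ) ⟨
    σ * (a * d)                      ≈⟨ *-congˡ (x≈x-y+y (a * d) (b * c')) ⟩
    σ * ((a * d - b * c') + b * c')  ≈⟨ *-congˡ (+-congʳ det≈1) ⟩
    σ * (1# + b * c')                ∎
    where
    open SetoidReasoning setoid
    x≈x-y+y : ∀ x y → x ≈ x - y + y
    x≈x-y+y = solve 2 (λ x y → x := x :- y :+ y) refl

  m11≈1⇒sandwich≈-Id : ∀ X → det X ≈ 1# → m11 X ≈ 1# → (Mₐ (m21 X) · (X · Mₐ (- m12 X))) ≈M -Id
  m11≈1⇒sandwich≈-Id X@(mat a b c' d) det≈1 a≈1 = begin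
    Mₐ c' · (X · Mₐ (- b))               ≈⟨ ·-cong ≈M.refl (·-cong X≈ ≈M.refl) ⟩
    Mₐ c' · (mat 1# b c' d′ · Mₐ (- b))  ≈⟨ sandwich≈ c' (- b) 1# b c' d′ ⟩
    mat (c' * (1# * - b + b) - (c' * - b + d′)) (c' - c' * 1#) (1# * - b + b) (- 1#)
      ≈⟨ solve 2 (λ b c' → c' :* (con (+ 1) :* (:- b) :+ b) :- (c' :* (:- b) :+ con (+ 1) :* (con (+ 1) :+ b :* c'))
                             := :- con (+ 1)) refl b c' ,
         solve 1 (λ c' → c' :- c' :* con (+ 1) := con (+ 0)) refl c' ,
         solve 1 (λ b → con (+ 1) :* (:- b) :+ b := con (+ 0)) refl b ,
         refl ⟩
    -Id                                  ∎
    where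
    open ≈M-Reasoning
    d′ : Carrier
    d′ = 1# * (1# + b * c')
    X≈ : X ≈M mat 1# b c' d′
    X≈ = a≈1 , refl , refl , det≈1⇒m22≈ X det≈1 a≈1 (inj₁ refl)

  m11≈-1⇒sandwich≈Id : ∀ X → det X ≈ 1# → m11 X ≈ - 1# → (Mₐ (- m21 X) · (X · Mₐ (m12 X))) ≈M Id
  m11≈-1⇒sandwich≈Id X@(mat a b c' d) det≈1 a≈-1 = begin
    Mₐ (- c') · (X · Mₐ b)                  ≈⟨ ·-cong ≈M.refl (·-cong X≈ ≈M.refl) ⟩
    Mₐ (- c') · (mat (- 1#) b c' d′ · Mₐ b)  ≈⟨ sandwich≈ (- c') b (- 1#) b c' d′ ⟩
    mat (- c' * (- 1# * b + b) - (c' * b + d′)) (c' - - c' * - 1#) (- 1# * b + b) (- - 1#)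
      ≈⟨ solve 2 (λ b c' → :- c' :* ((:- con (+ 1)) :* b :+ b)
                             :- (c' :* b :+ (:- con (+ 1)) :* (con (+ 1) :+ b :* c'))
                             := con (+ 1)) refl b c' ,
         solve 1 (λ c' → c' :- (:- c') :* (:- con (+ 1)) := con (+ 0)) refl c' ,
         solve 1 (λ b → (:- con (+ 1)) :* b :+ b := con (+ 0)) refl b ,
         -‿involutive 1# ⟩
    Id                                      ∎
    where
    open ≈M-Reasoning
    d′ : Carrier
    d′ = - 1# * (1# + b * c')
    X≈ : X ≈M mat (- 1#) b c' d′
    X≈ = a≈-1 , refl , refl , det≈1⇒m22≈ X det≈1 a≈-1 (inj₂ refl)

  m11≈±1⇒extendable : ∀ mid → m11 (Mₙ mid) ≈±1 → ∃[ y ] ∃[ x ] Mₙ (y ∷ mid ++ x ∷ []) ≈±Id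
  m11≈±1⇒extendable mid (inj₁ m11≈1) = - m12 (Mₙ mid) , m21 (Mₙ mid) ,
    inj₂ (≈M.trans (Mₙ-∷-∷ʳ _ mid _) (m11≈1⇒sandwich≈-Id (Mₙ mid) (det-Mₙ mid) m11≈1))
  m11≈±1⇒extendable mid (inj₂ m11≈-1) = m12 (Mₙ mid) , - m21 (Mₙ mid) ,
    inj₁ (≈M.trans (Mₙ-∷-∷ʳ _ mid _) (m11≈-1⇒sandwich≈Id (Mₙ mid) (det-Mₙ mid) m11≈-1))

module Tuples {c ℓ} (A : CommutativeRing c ℓ) where
  open CommutativeRing A
  open Q A
  open Matrices A
  open Lists

  module ≈L = Setoid (PW.setoid setoid)

  lastOr-∷ʳ : ∀ d xs y → lastOr d (xs ++ y ∷ []) ≡ y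
  lastOr-∷ʳ d []       y = P.refl
  lastOr-∷ʳ d (x ∷ xs) y = lastOr-∷ʳ x xs y

  dropLast-∷ʳ : ∀ xs y → dropLast (xs ++ y ∷ []) ≡ xs
  dropLast-∷ʳ []            y = P.refl
  dropLast-∷ʳ (x ∷ [])      y = P.refl
  dropLast-∷ʳ (x ∷ x′ ∷ xs) y = P.cong (x ∷_) (dropLast-∷ʳ (x′ ∷ xs) y)

  ⊕-∷-∷ʳ : ∀ a₁ amid aₘ b₁ bmid bₗ →
    ((a₁ ∷ amid ++ aₘ ∷ []) ⊕ (b₁ ∷ bmid ++ bₗ ∷ [])) ≡ (a₁ + bₗ) ∷ amid ++ (aₘ + b₁) ∷ bmid
  ⊕-∷-∷ʳ a₁ amid aₘ b₁ bmid bₗ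
    rewrite lastOr-∷ʳ b₁ bmid bₗ | lastOr-∷ʳ a₁ amid aₘ | dropLast-∷ʳ amid aₘ | dropLast-∷ʳ bmid bₗ
    = P.refl

  length-⊕ : ∀ as bs → 2 ≤ length as → 2 ≤ length bs → length (as ⊕ bs) ℕ.+ 2 ≡ length as ℕ.+ length bs
  length-⊕ as bs 2≤as 2≤bs with ∷-∷ʳ-view as 2≤as | ∷-∷ʳ-view bs 2≤bs
  ... | a₁ , amid , aₘ , P.refl | b₁ , bmid , bₗ , P.refl = begin
    length (as ⊕ bs) ℕ.+ 2
      ≡⟨ P.cong (λ t → length t ℕ.+ 2) (⊕-∷-∷ʳ a₁ amid aₘ b₁ bmid bₗ) ⟩
    suc (length (amid ++ (aₘ + b₁) ∷ bmid)) ℕ.+ 2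
      ≡⟨ P.cong (λ t → suc t ℕ.+ 2) (LP.length-++ amid) ⟩
    suc (length amid ℕ.+ suc (length bmid)) ℕ.+ 2
      ≡⟨ arithmetic (length amid) (length bmid) ⟩
    suc (suc (length amid)) ℕ.+ suc (suc (length bmid))
      ≡⟨ P.cong₂ ℕ._+_ (length-∷-∷ʳ a₁ amid aₘ) (length-∷-∷ʳ b₁ bmid bₗ) ⟨
    length as ℕ.+ length bs
      ∎
    where
    open P.≡-Reasoning
    arithmetic : ∀ a b → suc (a ℕ.+ suc b) ℕ.+ 2 ≡ suc (suc a) ℕ.+ suc (suc b)
    arithmetic = solve-∀

  rotate-++ : ∀ xs ys → rotate (length xs) (xs ++ ys) ≡ ys ++ xs
  rotate-++ xs ys = P.cong₂ _++_ (drop-++ xs) (take-++ xs)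
    where
    drop-++ : ∀ xs → drop (length xs) (xs ++ ys) ≡ ys
    drop-++ []       = P.refl
    drop-++ (x ∷ xs) = drop-++ xs
    take-++ : ∀ xs → take (length xs) (xs ++ ys) ≡ xs
    take-++ []       = P.refl
    take-++ (x ∷ xs) = P.cong (x ∷_) (take-++ xs)

  rotate-block : ∀ pre seg post → rotate (length (pre ++ seg)) (pre ++ seg ++ post) ≡ (post ++ pre) ++ seg
  rotate-block pre seg post = begin
    rotate k (pre ++ seg ++ post)    ≡⟨ P.cong (rotate k) (LP.++-assoc pre seg post) ⟨
    rotate k ((pre ++ seg) ++ post)  ≡⟨ rotate-++ (pre ++ seg) post ⟩
    post ++ pre ++ seg               ≡⟨ LP.++-assoc post pre seg ⟨
    (post ++ pre) ++ seg             ∎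
    where
    open P.≡-Reasoning
    k : ℕ
    k = length (pre ++ seg)

  rotate-≥ : ∀ {k} xs → length xs ≤ k → rotate k xs ≡ xs
  rotate-≥ {k} xs xs≤k = P.cong₂ _++_ (LP.drop-all k xs xs≤k) (LP.take-all k xs xs≤k)

  length-rotate : ∀ k xs → length (rotate k xs) ≡ length xs
  length-rotate k xs = begin
    length (drop k xs ++ take k xs)            ≡⟨ LP.length-++ (drop k xs) ⟩
    length (drop k xs) ℕ.+ length (take k xs)  ≡⟨ ℕP.+-comm (length (drop k xs)) _ ⟩
    length (take k xs) ℕ.+ length (drop k xs)  ≡⟨ LP.length-++ (take k xs) ⟨
    length (take k xs ++ drop k xs)            ≡⟨ P.cong length (LP.take++drop≡id k xs) ⟩
    length xs                                  ∎
    where open P.≡-Reasoning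

  length-∼ : ∀ {xs ys} → xs ∼ ys → length xs ≡ length ys
  length-∼ {xs} (k , inj₁ rot≈) = P.trans (P.sym (length-rotate k xs)) (PW.Pointwise-length rot≈)
  length-∼ {xs} (k , inj₂ rot≈) =
    P.trans (P.sym (LP.length-reverse xs)) (P.trans (P.sym (length-rotate k (reverse xs))) (PW.Pointwise-length rot≈))

  All-rotate : ∀ {p} {Pr : Carrier → Set p} k {xs} → All Pr xs → All Pr (rotate k xs)
  All-rotate k pxs = AllP.++⁺ (AllP.drop⁺ k pxs) (AllP.take⁺ k pxs)

  All-∼ : ∀ {p} {Pr : Carrier → Set p} → (∀ {x y} → x ≈ y → Pr x → Pr y) →
    ∀ {xs ys} → All Pr xs → xs ∼ ys → All Pr ys
  All-∼ resp pxs (k , inj₁ rot≈) = PW.All-resp-Pointwise resp rot≈ (All-rotate k pxs)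
  All-∼ resp pxs (k , inj₂ rot≈) = PW.All-resp-Pointwise resp rot≈ (All-rotate k (All-reverse pxs))

  take-cong : ∀ k {xs ys} → xs ≈L ys → take k xs ≈L take k ys
  take-cong zero    _             = []
  take-cong (suc k) []            = []
  take-cong (suc k) (x≈y ∷ xs≈ys) = x≈y ∷ take-cong k xs≈ys

  drop-cong : ∀ k {xs ys} → xs ≈L ys → drop k xs ≈L drop k ys
  drop-cong zero    xs≈ys       = xs≈ys
  drop-cong (suc k) []          = []
  drop-cong (suc k) (_ ∷ xs≈ys) = drop-cong k xs≈ys

  rotate-cong : ∀ k {xs ys} → xs ≈L ys → rotate k xs ≈L rotate k ys
  rotate-cong k xs≈ys = PW.++⁺ (drop-cong k xs≈ys) (take-cong k xs≈ys)

  lastOr-cong : ∀ {d d′ xs ys} → d ≈ d′ → xs ≈L ys → lastOr d xs ≈ lastOr d′ ys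
  lastOr-cong d≈d′ []            = d≈d′
  lastOr-cong _    (x≈y ∷ xs≈ys) = lastOr-cong x≈y xs≈ys

  dropLast-cong : ∀ {xs ys} → xs ≈L ys → dropLast xs ≈L dropLast ys
  dropLast-cong []                    = []
  dropLast-cong (x≈y ∷ [])            = []
  dropLast-cong (x≈y ∷ x′≈y′ ∷ xs≈ys) = x≈y ∷ dropLast-cong (x′≈y′ ∷ xs≈ys)

  ⊕-cong : ∀ {as as′ bs bs′} → as ≈L as′ → bs ≈L bs′ → (as ⊕ bs) ≈L (as′ ⊕ bs′)
  ⊕-cong []           bs≈        = bs≈
  ⊕-cong (a≈ ∷ as≈) []           = a≈ ∷ as≈
  ⊕-cong (a≈ ∷ as≈) (b≈ ∷ bs≈) =
    +-cong a≈ (lastOr-cong b≈ bs≈) ∷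
    PW.++⁺ (dropLast-cong as≈) (+-cong (lastOr-cong a≈ as≈) b≈ ∷ dropLast-cong bs≈)

  ∼-respˡ : ∀ {xs xs′ ys} → xs ≈L xs′ → xs′ ∼ ys → xs ∼ ys
  ∼-respˡ xs≈ (k , inj₁ rot≈) = k , inj₁ (≈L.trans (rotate-cong k xs≈) rot≈)
  ∼-respˡ xs≈ (k , inj₂ rot≈) = k , inj₂ (≈L.trans (rotate-cong k (PW.reverse⁺ xs≈)) rot≈)

  ∼-respʳ : ∀ {xs ys ys′} → xs ∼ ys → ys ≈L ys′ → xs ∼ ys′
  ∼-respʳ (k , inj₁ rot≈) ys≈ = k , inj₁ (≈L.trans rot≈ ys≈)
  ∼-respʳ (k , inj₂ rot≈) ys≈ = k , inj₂ (≈L.trans rot≈ ys≈)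

  module _ {p} {R : Carrier → Set p} (R-resp : ∀ {x y} → x ≈ y → R x → R y) where

    IsλQuiddity-resp : ∀ {xs ys} → xs ≈L ys → IsλQuiddity R xs → IsλQuiddity R ys
    IsλQuiddity-resp xs≈ys (1≤xs , xs∈R , M≈±Id) =
      P.subst (1 ≤_) (PW.Pointwise-length xs≈ys) 1≤xs ,
      PW.All-resp-Pointwise R-resp xs≈ys xs∈R ,
      Sum.map (≈M.trans (≈M.sym (Mₙ-cong xs≈ys))) (≈M.trans (≈M.sym (Mₙ-cong xs≈ys))) M≈±Id

    Reducible-resp : ∀ {xs ys} → xs ≈L ys → Reducible R xs → Reducible R ys
    Reducible-resp xs≈ys (xs-quid , 3≤xs , as , bs , split) =
      IsλQuiddity-resp xs≈ys xs-quid , P.subst (3 ≤_) (PW.Pointwise-length xs≈ys) 3≤xs , as , bs ,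
      Product.map₂ (Product.map₂ (Product.map₂ (Product.map₂ (∼-respˡ (≈L.sym xs≈ys))))) split

    Irreducible-resp : ∀ {xs ys} → xs ≈L ys → Irreducible R xs → Irreducible R ys
    Irreducible-resp xs≈ys (xs-quid , ¬reducible , xs≉00) =
      IsλQuiddity-resp xs≈ys xs-quid , (λ red → ¬reducible (Reducible-resp (≈L.sym xs≈ys) red)) ,
      (λ ys≈00 → xs≉00 (≈L.trans xs≈ys ys≈00))

-- Criteria for reducibility

module Reduction {c ℓ} (A : CommutativeRing c ℓ) where
  open CommutativeRing A
  open RingSolver A using (solve; _:=_; _:+_; _:-_)
  open Q A
  open Matrices A
  open Tuples A
  open Lists

  all-Whole : ∀ xs → All Whole xs
  all-Whole = All.universal (λ _ → tt)

  module _ {p} (R : Carrier → Set p) where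

    rotation-splits⇒reducible : ∀ {q} k a₁ amid aₘ b₁ bmid bₗ →
      IsλQuiddity R q → All R (a₁ ∷ amid ++ aₘ ∷ []) → IsλQuiddity R (b₁ ∷ bmid ++ bₗ ∷ []) →
      1 ≤ length amid → 1 ≤ length bmid →
      rotate k q ≈L ((a₁ + bₗ) ∷ amid ++ (aₘ + b₁) ∷ bmid) → Reducible R q
    rotation-splits⇒reducible {q} k a₁ amid aₘ b₁ bmid bₗ q-quid as∈R bs-quid 1≤amid 1≤bmid rot≈ =
      q-quid , 3≤q , _ , _ , bs-quid , as∈R ,
      3≤length-∷-∷ʳ a₁ amid aₘ 1≤amid , 3≤length-∷-∷ʳ b₁ bmid bₗ 1≤bmid ,
      k , inj₁ (≈L.trans rot≈ (≈L.reflexive (P.sym (⊕-∷-∷ʳ a₁ amid aₘ b₁ bmid bₗ))))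
      where
      3≤q : 3 ≤ length q
      3≤q = P.subst (3 ≤_) (P.trans (P.sym (PW.Pointwise-length rot≈)) (length-rotate k q))
              (P.subst (λ n → 3 ≤ suc n) (P.sym (LP.length-++ amid)) (s≤s (ℕP.+-mono-≤ 1≤amid (s≤s z≤n))))

    -- q, rotated to (sₗ, post, pre, s₁, smid), is (0, post ++ pre, 0) ⊕ (s₁, smid, sₗ).
    Id-block⇒reducible : ∀ {q} pre seg post → q ≡ pre ++ seg ++ post → IsλQuiddity R q → R 0# →
      3 ≤ length seg → 1 ≤ length (post ++ pre) → Mₙ seg ≈M Id → Reducible R q
    Id-block⇒reducible pre seg post P.refl q-quid@(_ , q∈R , _) 0∈R 3≤seg 1≤rest seg≈Id
      with ∷-∷ʳ-view seg (ℕP.≤-trans (ℕP.n≤1+n 2) 3≤seg)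
    ... | s₁ , smid , sₗ , P.refl =
      let pre∈R , seg++post∈R = AllP.++⁻ pre q∈R
          seg∈R , post∈R      = AllP.++⁻ (s₁ ∷ smid ++ sₗ ∷ []) seg++post∈R
      in rotation-splits⇒reducible k 0# (post ++ pre) 0# s₁ smid sₗ q-quid
           (0∈R ∷ AllP.++⁺ (AllP.++⁺ post∈R pre∈R) (0∈R ∷ [])) (s≤s z≤n , seg∈R , inj₁ seg≈Id)
           1≤rest (1≤length-middle s₁ smid sₗ 3≤seg) rot≈
      where
      k : ℕ
      k = length (pre ++ s₁ ∷ smid)
      rot≈ : rotate k (pre ++ (s₁ ∷ smid ++ sₗ ∷ []) ++ post)
               ≈L ((0# + sₗ) ∷ (post ++ pre) ++ (0# + s₁) ∷ smid)
      rot≈ = ≈L.trans (≈L.reflexive (begin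
        rotate k (pre ++ (s₁ ∷ smid ++ sₗ ∷ []) ++ post)
          ≡⟨ P.cong (λ t → rotate k (pre ++ s₁ ∷ t)) (LP.++-assoc smid (sₗ ∷ []) post) ⟩
        rotate k (pre ++ (s₁ ∷ smid) ++ sₗ ∷ post)        ≡⟨ rotate-block pre (s₁ ∷ smid) (sₗ ∷ post) ⟩
        sₗ ∷ (post ++ pre) ++ s₁ ∷ smid                   ∎))
        (sym (+-identityˡ sₗ) ∷ PW.++⁺ ≈L.refl (sym (+-identityˡ s₁) ∷ ≈L.refl))
        where open P.≡-Reasoning

  -- With (y, seg, x) the λ-quiddity given by m11≈±1⇒extendable, q rotated to (r₁, rmid, rₘ, seg)
  -- is (r₁ - x, rmid, rₘ - y) ⊕ (y, seg, x).
  m11≈±1-block⇒reducible : ∀ {q} pre seg post → q ≡ pre ++ seg ++ post → IsλQuiddity Whole q →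
    1 ≤ length seg → 3 ≤ length (post ++ pre) → m11 (Mₙ seg) ≈±1 → Reducible Whole q
  m11≈±1-block⇒reducible pre seg post P.refl q-quid 1≤seg 3≤rest m11≈±1
    with ∷-∷ʳ-view (post ++ pre) (ℕP.≤-trans (ℕP.n≤1+n 2) 3≤rest) | m11≈±1⇒extendable seg m11≈±1
  ... | r₁ , rmid , rₘ , rest≡ | y , x , extension≈±Id =
    rotation-splits⇒reducible Whole (length (pre ++ seg)) (r₁ - x) rmid (rₘ - y) y seg x q-quid
      (all-Whole _) (s≤s z≤n , all-Whole _ , extension≈±Id)
      (1≤length-middle r₁ rmid rₘ (P.subst (λ t → 3 ≤ length t) rest≡ 3≤rest)) 1≤seg rot≈
    where
    u-v+v≈u : ∀ u v → u - v + v ≈ u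
    u-v+v≈u = solve 2 (λ u v → u :- v :+ v := u) refl
    rot≈ : rotate (length (pre ++ seg)) (pre ++ seg ++ post) ≈L ((r₁ - x + x) ∷ rmid ++ (rₘ - y + y) ∷ seg)
    rot≈ = ≈L.trans (≈L.reflexive (begin
      rotate (length (pre ++ seg)) (pre ++ seg ++ post)  ≡⟨ rotate-block pre seg post ⟩
      (post ++ pre) ++ seg                               ≡⟨ P.cong (_++ seg) rest≡ ⟩
      r₁ ∷ (rmid ++ rₘ ∷ []) ++ seg                      ≡⟨ P.cong (r₁ ∷_) (LP.++-assoc rmid _ seg) ⟩
      r₁ ∷ rmid ++ rₘ ∷ seg                              ∎))
      (sym (u-v+v≈u r₁ x) ∷ PW.++⁺ ≈L.refl (sym (u-v+v≈u rₘ y) ∷ ≈L.refl))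
      where open P.≡-Reasoning

  All≈⇒≈replicate : ∀ {v xs} → All (_≈ v) xs → xs ≈L replicate (length xs) v
  All≈⇒≈replicate []           = []
  All≈⇒≈replicate (x≈v ∷ xs≈v) = x≈v ∷ All≈⇒≈replicate xs≈v

  -- In a splitting of a constant tuple, the middle of the second summand is a constant block.
  replicate-irreducible : ∀ k v → IsλQuiddity Whole (replicate k v) → 3 ≤ k →
    (∀ L → 1 ≤ L → L ℕ.+ 3 ≤ k → ¬ (m11 (Mₙ (replicate L v)) ≈±1)) → Irreducible Whole (replicate k v)
  replicate-irreducible k v quid 3≤k no-corner = quid , ¬reducible , ≉00
    where
    ≉00 : ¬ (replicate k v ≈L (0# ∷ 0# ∷ []))
    ≉00 ≈00 = ℕP.<-irrefl P.refl
      (P.subst (3 ≤_) (P.trans (P.sym (LP.length-replicate k)) (PW.Pointwise-length ≈00)) 3≤k)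
    ¬reducible : ¬ Reducible Whole (replicate k v)
    ¬reducible (_ , _ , as , bs , (_ , _ , bs≈±Id) , _ , 3≤as , 3≤bs , q∼as⊕bs)
      with ∷-∷ʳ-view as (ℕP.≤-trans (ℕP.n≤1+n 2) 3≤as)
         | ∷-∷ʳ-view bs (ℕP.≤-trans (ℕP.n≤1+n 2) 3≤bs)
    ... | a₁ , amid , aₘ , P.refl | b₁ , bmid , bₗ , P.refl =
      no-corner (length bmid) (1≤length-middle b₁ bmid bₗ 3≤bs) L+3≤k
        (≈±1-resp (proj₁ (Mₙ-cong (All≈⇒≈replicate bmid≈v))) (extendable⇒m11≈±1 b₁ bmid bₗ bs≈±Id))
      where
      q∼X : replicate k v ∼ ((a₁ + bₗ) ∷ amid ++ (aₘ + b₁) ∷ bmid)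
      q∼X = P.subst (replicate k v ∼_) (⊕-∷-∷ʳ a₁ amid aₘ b₁ bmid bₗ) q∼as⊕bs
      bmid≈v : All (_≈ v) bmid
      bmid≈v = All.tail (AllP.++⁻ʳ amid (All.tail
        (All-∼ (λ x≈y x≈v → trans (sym x≈y) x≈v) (AllP.replicate⁺ k refl) q∼X)))
      L+3≤k : length bmid ℕ.+ 3 ≤ k
      L+3≤k = P.subst₂ _≤_ (ℕP.+-comm 3 (length bmid))
        (P.trans (P.cong suc (P.sym (LP.length-++ amid))) (P.trans (P.sym (length-∼ q∼X)) (LP.length-replicate k)))
        (s≤s (ℕP.+-monoˡ-≤ (suc (length bmid)) (1≤length-middle a₁ amid aₘ 3≤as)))

  module _ {q} (q-irreducible : Irreducible Whole q) where

    -- A coincidence with i < j makes the block between positions i and j have top-left entry ±1.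
    lower-prefix-injective : ∀ {i j σ σ′ t t′} → i ≤ j → j ℕ.+ 3 ≤ length q → σ ≈±1 → σ′ ≈±1 →
      (lower σ t · Mₙ (take i q)) ≈M (lower σ′ t′ · Mₙ (take j q)) → i ≡ j × σ ≈ σ′ × t ≈ t′
    lower-prefix-injective {i} {j} {σ} {σ′} {t} {t′} i≤j j+3≤q σ≈±1 σ′≈±1 eq
      with ℕP.m≤n⇒m<n∨m≡n i≤j
    ... | inj₂ P.refl = P.refl , proj₁ lower≈ , proj₁ (proj₂ (proj₂ lower≈))
      where
      lower≈ : lower σ t ≈M lower σ′ t′
      lower≈ = ·-cancelʳ (lower σ t) (lower σ′ t′) (det-Mₙ (take i q)) eq
    ... | inj₁ i<j = ⊥-elim (proj₁ (proj₂ q-irreducible)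
                       (m11≈±1-block⇒reducible (take i q) S (drop j q) (take-slice-drop q i≤j) (proj₁ q-irreducible)
                         1≤S 3≤rest (≈±1-resp σ′σ≈m11 (≈±1-* σ′≈±1 σ≈±1))))
      where
      S : List Carrier
      S = slice i j q
      lower≈ : lower σ t ≈M (lower σ′ t′ · Mₙ S)
      lower≈ = ·-cancelʳ (lower σ t) (lower σ′ t′ · Mₙ S) (det-Mₙ (take i q)) (begin
        lower σ t · Mₙ (take i q)             ≈⟨ eq ⟩
        lower σ′ t′ · Mₙ (take j q)           ≈⟨ ·-cong ≈M.refl (Mₙ-take-slice q i≤j) ⟩
        lower σ′ t′ · (Mₙ S · Mₙ (take i q))  ≈⟨ ·-assoc (lower σ′ t′) (Mₙ S) (Mₙ (take i q)) ⟨
        (lower σ′ t′ · Mₙ S) · Mₙ (take i q)  ∎)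
        where open ≈M-Reasoning
      σ′σ≈m11 : σ′ * σ ≈ m11 (Mₙ S)
      σ′σ≈m11 = begin
        σ′ * σ                                    ≈⟨ *-congˡ (proj₁ lower≈) ⟩
        σ′ * (σ′ * m11 (Mₙ S) + 0# * m21 (Mₙ S))  ≈⟨ *-congˡ (trans (+-congˡ (zeroˡ _)) (+-identityʳ _)) ⟩
        σ′ * (σ′ * m11 (Mₙ S))                    ≈⟨ *-assoc σ′ σ′ _ ⟨
        (σ′ * σ′) * m11 (Mₙ S)                    ≈⟨ *-congʳ (≈±1⇒x*x≈1 σ′≈±1) ⟩
        1# * m11 (Mₙ S)                           ≈⟨ *-identityˡ _ ⟩
        m11 (Mₙ S)                                ∎
        where open SetoidReasoning setoid
      1≤S : 1 ≤ length S
      1≤S = P.subst (1 ≤_) (P.sym (length-slice i q (ℕP.≤-trans (ℕP.m≤m+n j 3) j+3≤q)))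
                           (ℕP.m<n⇒0<n∸m i<j)
      3≤rest : 3 ≤ length (drop j q ++ take i q)
      3≤rest = ℕP.≤-trans (P.subst (3 ≤_) (P.sym (LP.length-drop j q)) (ℕP.m+n≤o⇒m≤o∸n 3 3+j≤q))
                          (LP.length-++-≤ˡ (drop j q))
        where
        3+j≤q : 3 ℕ.+ j ≤ length q
        3+j≤q = P.subst (_≤ length q) (ℕP.+-comm j 3) j+3≤q

-- Two irreducible families

module Families {c ℓ} (A : CommutativeRing c ℓ)
  (1≉0 : ¬ CommutativeRing._≈_ A (CommutativeRing.1# A) (CommutativeRing.0# A)) where
  open CommutativeRing A
  open import Algebra.Properties.Ring ring using (-‿involutive; -0#≈0#; +-identityʳ-unique)
  open RingSolver A using (solve; _:=_; con; _:+_; _:*_; :-_; _:-_)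
  open Q A
  open Matrices A
  open Reduction A

  -1≉0 : ¬ (- 1# ≈ 0#)
  -1≉0 -1≈0 = 1≉0 (trans (sym (-‿involutive 1#)) (trans (-‿cong -1≈0) -0#≈0#))

  -- (0, 0) is the extension of the empty tuple, whose monodromy Id has top-left entry 1.
  00≈-Id : Mₙ (0# ∷ 0# ∷ []) ≈M -Id
  00≈-Id = begin
    Mₙ (0# ∷ [] ++ 0# ∷ [])   ≈⟨ Mₙ-∷-∷ʳ 0# [] 0# ⟩
    Mₐ 0# · (Id · Mₐ 0#)      ≈⟨ ·-cong ≈M.refl (·-cong ≈M.refl (Mₐ-cong -0#≈0#)) ⟨
    Mₐ 0# · (Id · Mₐ (- 0#))  ≈⟨ m11≈1⇒sandwich≈-Id Id (det-Mₙ []) refl ⟩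
    -Id                       ∎
    where open ≈M-Reasoning

  -Id·-Id≈Id : (-Id · -Id) ≈M Id
  -Id·-Id≈Id = solve 0 ((:- con (+ 1)) :* (:- con (+ 1)) :+ con (+ 0) :* con (+ 0) := con (+ 1)) refl ,
               solve 0 ((:- con (+ 1)) :* con (+ 0) :+ con (+ 0) :* (:- con (+ 1)) := con (+ 0)) refl ,
               solve 0 (con (+ 0) :* (:- con (+ 1)) :+ (:- con (+ 1)) :* con (+ 0) := con (+ 0)) refl ,
               solve 0 (con (+ 0) :* con (+ 0) :+ (:- con (+ 1)) :* (:- con (+ 1)) := con (+ 1)) refl

  0000-irreducible : Irreducible Whole (replicate 4 0#)
  0000-irreducible =
    replicate-irreducible 4 0# (s≤s z≤n , all-Whole _ , inj₁ 0000≈Id) (s≤s (s≤s (s≤s z≤n))) no-corner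
    where
    0000≈Id : Mₙ (replicate 4 0#) ≈M Id
    0000≈Id = ≈M.trans (Mₙ-++ (0# ∷ 0# ∷ []) (0# ∷ 0# ∷ []))
                       (≈M.trans (·-cong 00≈-Id 00≈-Id) -Id·-Id≈Id)
    m11-0≈0 : m11 (Mₙ (0# ∷ [])) ≈ 0#
    m11-0≈0 = proj₁ (≈M.trans (Mₙ-∷ 0# []) (·-identityˡ (Mₐ 0#)))
    no-corner : ∀ L → 1 ≤ L → L ℕ.+ 3 ≤ 4 → ¬ (m11 (Mₙ (replicate L 0#)) ≈±1)
    no-corner 1 _ _ (inj₁ m11≈1)  = 1≉0 (trans (sym m11≈1) m11-0≈0)
    no-corner 1 _ _ (inj₂ m11≈-1) = -1≉0 (trans (sym m11≈-1) m11-0≈0)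
    no-corner (suc (suc L)) _ (s≤s (s≤s L+3≤2)) _ with ℕP.≤-trans (ℕP.m≤n+m 3 L) L+3≤2
    ... | s≤s (s≤s ())

  two : Carrier
  two = 1# + 1#

  Mₙ-twos : ∀ L → Mₙ (replicate L two) ≈M mat (1# + natToA L) (- natToA L) (natToA L) (1# - natToA L)
  Mₙ-twos zero    = sym (+-identityʳ 1#) , sym -0#≈0# , refl , sym (trans (+-congˡ -0#≈0#) (+-identityʳ 1#))
  Mₙ-twos (suc L) = begin
    Mₙ (two ∷ replicate L two)                                 ≈⟨ Mₙ-∷ two (replicate L two) ⟩
    Mₙ (replicate L two) · Mₐ two                              ≈⟨ ·-cong (Mₙ-twos L) ≈M.refl ⟩
    mat (1# + X) (- X) X (1# - X) · Mₐ two                     ≈⟨ step ⟩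
    mat (1# + (1# + X)) (- (1# + X)) (1# + X) (1# - (1# + X))  ∎
    where
    open ≈M-Reasoning
    X : Carrier
    X = natToA L
    step : (mat (1# + X) (- X) X (1# - X) · Mₐ two) ≈M mat (1# + (1# + X)) (- (1# + X)) (1# + X) (1# - (1# + X))
    step =
      solve 1 (λ X → (con (+ 1) :+ X) :* (con (+ 1) :+ con (+ 1)) :+ (:- X) :* con (+ 1)
                       := con (+ 1) :+ (con (+ 1) :+ X)) refl X ,
      solve 1 (λ X → (con (+ 1) :+ X) :* (:- con (+ 1)) :+ (:- X) :* con (+ 0) := :- (con (+ 1) :+ X)) refl X ,
      solve 1 (λ X → X :* (con (+ 1) :+ con (+ 1)) :+ (con (+ 1) :- X) :* con (+ 1) := con (+ 1) :+ X) refl X ,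
      solve 1 (λ X → X :* (:- con (+ 1)) :+ (con (+ 1) :- X) :* con (+ 0) := con (+ 1) :- (con (+ 1) :+ X)) refl X

  twos-irreducible : ∀ k → IsCharacteristic k → 5 ≤ k → Irreducible Whole (replicate k two)
  twos-irreducible k (_ , k≈0 , k-minimal) 5≤k =
    replicate-irreducible k two (1≤k , all-Whole _ , inj₁ twos≈Id) (ℕP.≤-trans (ℕP.m≤m+n 3 2) 5≤k) no-corner
    where
    1≤k : 1 ≤ length (replicate k two)
    1≤k = P.subst (1 ≤_) (P.sym (LP.length-replicate k)) (ℕP.≤-trans (s≤s z≤n) 5≤k)
    twos≈Id : Mₙ (replicate k two) ≈M Id
    twos≈Id = ≈M.trans (Mₙ-twos k)
      ( trans (+-congˡ k≈0) (+-identityʳ 1#)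
      , trans (-‿cong k≈0) -0#≈0#
      , k≈0
      , trans (+-congˡ (trans (-‿cong k≈0) -0#≈0#)) (+-identityʳ 1#))
    -- A corner ±1 would make L or L + 2, both in [1, k), vanish in A.
    no-corner : ∀ L → 1 ≤ L → L ℕ.+ 3 ≤ k → ¬ (m11 (Mₙ (replicate L two)) ≈±1)
    no-corner L 1≤L L+3≤k (inj₁ m11≈1) =
      ℕP.<⇒≱ (ℕP.<-≤-trans (ℕP.m<m+n L (s≤s z≤n)) L+3≤k) (k-minimal L 1≤L L≈0)
      where
      L≈0 : natToA L ≈ 0#
      L≈0 = +-identityʳ-unique 1# (natToA L) (trans (sym (proj₁ (Mₙ-twos L))) m11≈1)
    no-corner L 1≤L L+3≤k (inj₂ m11≈-1) =
      ℕP.<⇒≱ (P.subst (_≤ k) (ℕP.+-comm L 3) L+3≤k) (k-minimal (2 ℕ.+ L) (s≤s z≤n) 2+L≈0)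
      where
      2+L≈0 : natToA (2 ℕ.+ L) ≈ 0#
      2+L≈0 = trans (+-congˡ (trans (sym (proj₁ (Mₙ-twos L))) m11≈-1)) (-‿inverseʳ 1#)

  characteristic≢2⇒1+1≉0 : ∀ {k} → IsCharacteristic k → k ≢ 2 → ¬ (1# + 1# ≈ 0#)
  characteristic≢2⇒1+1≉0 {k} (1≤k , k≈0 , k-minimal) k≢2 1+1≈0 =
    k≢2 (ℕP.≤-antisym (k-minimal 2 (s≤s z≤n) (trans (+-congˡ (+-identityʳ 1#)) 1+1≈0)) (2≤k k 1≤k k≈0))
    where
    2≤k : ∀ k → 1 ≤ k → natToA k ≈ 0# → 2 ≤ k
    2≤k 1             _ 1≈0 = ⊥-elim (1≉0 (trans (sym (+-identityʳ 1#)) 1≈0))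
    2≤k (suc (suc _)) _ _   = s≤s (s≤s z≤n)

  4⊔characteristic≤ : ∀ {m k} → (∀ q → Irreducible Whole q → length q ≤ m) → IsCharacteristic k →
    4 ℕ.⊔ k ≤ m
  4⊔characteristic≤ {m} {k} maximal char with k ℕ.≤? 4
  ... | yes k≤4 = P.subst (_≤ m) (P.sym (ℕP.m≥n⇒m⊔n≡m k≤4)) (maximal _ 0000-irreducible)
  ... | no  k≰4 = P.subst (_≤ m) (P.sym (ℕP.m≤n⇒m⊔n≡n (ℕP.<⇒≤ (ℕP.≰⇒> k≰4))))
      (P.subst (_≤ m) (LP.length-replicate k) (maximal _ (twos-irreducible k char (ℕP.≰⇒> k≰4))))

module FiniteRing {c ℓ} (A : CommutativeRing c ℓ) {n} (A↔Fin : Inverse (CommutativeRing.setoid A) (P.setoid (Fin n)))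
  where
  open CommutativeRing A
  open import Level using (_⊔_)
  open import Algebra.Properties.Ring ring using (+-identityʳ-unique)
  open import Algebra.Properties.Monoid.Mult +-monoid using () renaming (_×_ to _·ℕ_; ×-homo-+ to ·ℕ-homo-+)
  open Q A
  open Matrices A
  open Tuples A
  open Reduction A
  open Lists
  open Counting
  open Inverse A↔Fin using (to; from; to-cong; strictlyInverseˡ; strictlyInverseʳ)

  to-injective : ∀ {x y} → to x ≡ to y → x ≈ y
  to-injective = Injection.injective (Inverse⇒Injection A↔Fin)

  from-injective : ∀ {u u′} → from u ≈ from u′ → u ≡ u′
  from-injective {u} {u′} eq = P.trans (P.sym (strictlyInverseˡ u)) (P.trans (to-cong eq) (strictlyInverseˡ u′))

  _≟_ : ∀ x y → Dec (x ≈ y)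
  x ≟ y = Dec.map′ to-injective to-cong (to x Fin.≟ to y)

  elements : List Carrier
  elements = List.map from (List.allFin n)

  ∈-elements : ∀ x → Any (x ≈_) elements
  ∈-elements x = AnyP.map⁺ (Any.map (λ { P.refl → sym (strictlyInverseʳ x) }) (∈-allFin (to x)))

  tuples : ℕ → List (List Carrier)
  tuples zero    = [] ∷ []
  tuples (suc k) = List.cartesianProductWith _∷_ elements (tuples k)

  ∈-tuples : ∀ q → Any (q ≈L_) (tuples (length q))
  ∈-tuples []      = here []
  ∈-tuples (x ∷ q) = AnyP.cartesianProductWith⁺ _∷_ _∷_ (∈-elements x) (∈-tuples q)

  tuplesUpTo : ℕ → List (List Carrier)
  tuplesUpTo B = List.concatMap tuples (List.upTo (suc B))

  ∈-tuplesUpTo : ∀ {B} q → length q ≤ B → Any (q ≈L_) (tuplesUpTo B)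
  ∈-tuplesUpTo q q≤B = AnyP.concatMap⁺ tuples (Any.map (λ { P.refl → ∈-tuples q }) (∈-upTo⁺ (s≤s q≤B)))

  #matrices : ℕ
  #matrices = n ℕ.* (n ℕ.* (n ℕ.* n))

  encode : Mat → Fin #matrices
  encode (mat a b c' d) = Fin.combine (to a) (Fin.combine (to b) (Fin.combine (to c') (to d)))

  encode-injective : ∀ X Y → encode X ≡ encode Y → X ≈M Y
  encode-injective (mat _ _ _ _) (mat _ _ _ _) eq
    with FinP.combine-injective _ _ _ _ eq
  ... | a≡ , eq′ with FinP.combine-injective _ _ _ _ eq′
  ... | b≡ , eq″ with FinP.combine-injective _ _ _ _ eq″
  ... | c≡ , d≡ = to-injective a≡ , to-injective b≡ , to-injective c≡ , to-injective d≡

  -- Finitely many irreducible λ-quiddities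

  module _ {p} {R : Carrier → Set p} (R-resp : ∀ {x y} → x ≈ y → R x → R y)
           (R-+ : ∀ {x y} → R x → R y → R (x + y)) where

    multiples∈R : ∀ k {x} → R x → R (suc k ·ℕ x)
    multiples∈R zero    x∈R = R-resp (sym (+-identityʳ _)) x∈R
    multiples∈R (suc k) x∈R = R-+ x∈R (multiples∈R k x∈R)

    -- Two of the multiples x, 2x, …, (n+1)x coincide, so some (d+1)x vanishes.
    0∈R : ∀ {x} → R x → R 0#
    0∈R {x} x∈R with FinP.pigeonhole (ℕP.n<1+n n) (λ (i : Fin (suc n)) → to (suc (toℕ i) ·ℕ x))
    ... | i , j , i<j , same = R-resp (+-identityʳ-unique _ _ (sym multiples≈)) (multiples∈R d x∈R)
      where
      d : ℕ
      d = proj₁ (ℕP.m≤n⇒∃[o]m+o≡n i<j)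
      1+j≡ : suc (toℕ j) ≡ suc (toℕ i) ℕ.+ suc d
      1+j≡ = P.trans (P.cong suc (P.sym (proj₂ (ℕP.m≤n⇒∃[o]m+o≡n i<j)))) (P.sym (ℕP.+-suc (suc (toℕ i)) d))
      multiples≈ : suc (toℕ i) ·ℕ x ≈ suc (toℕ i) ·ℕ x + suc d ·ℕ x
      multiples≈ = trans (to-injective same)
        (trans (reflexive (P.cong (_·ℕ x) 1+j≡)) (·ℕ-homo-+ x (suc (toℕ i)) (suc d)))

    -- Prefixes are sampled at multiples of 3 so that the repeating block has size ≥ 3.
    long⇒reducible : ∀ {q} → IsλQuiddity R q → 3 ℕ.* #matrices < length q → Reducible R q
    long⇒reducible {q} q-quid@(_ , x∈R ∷ _ , _) long
      with FinP.pigeonhole (ℕP.n<1+n #matrices) (λ i → encode (Mₙ (take (3 ℕ.* toℕ i) q)))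
    ... | i , j , i<j , same =
      Id-block⇒reducible R (take a q) (slice a b q) (drop b q) (take-slice-drop q a≤b) q-quid (0∈R x∈R)
        3≤slice 1≤rest slice≈Id
      where
      a b : ℕ
      a = 3 ℕ.* toℕ i
      b = 3 ℕ.* toℕ j
      a≤b : a ≤ b
      a≤b = ℕP.*-monoʳ-≤ 3 (ℕP.<⇒≤ i<j)
      b<q : b < length q
      b<q = ℕP.≤-<-trans (ℕP.*-monoʳ-≤ 3 (ℕP.≤-pred (FinP.toℕ<n j))) long
      3≤slice : 3 ≤ length (slice a b q)
      3≤slice = P.subst (3 ≤_)
        (P.trans (ℕP.*-distribˡ-∸ 3 (toℕ j) (toℕ i)) (P.sym (length-slice a q (ℕP.<⇒≤ b<q))))
        (ℕP.*-monoʳ-≤ 3 (ℕP.m<n⇒0<n∸m i<j))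
      1≤rest : 1 ≤ length (drop b q ++ take a q)
      1≤rest = ℕP.≤-trans (P.subst (1 ≤_) (P.sym (LP.length-drop b q)) (ℕP.m<n⇒0<n∸m b<q))
                          (LP.length-++-≤ˡ (drop b q))
      slice≈Id : Mₙ (slice a b q) ≈M Id
      slice≈Id = ·-cancelʳ (Mₙ (slice a b q)) Id (det-Mₙ (take a q)) (begin
        Mₙ (slice a b q) · Mₙ (take a q)  ≈⟨ Mₙ-take-slice q a≤b ⟨
        Mₙ (take b q)                     ≈⟨ encode-injective _ _ same ⟨
        Mₙ (take a q)                     ≈⟨ ·-identityˡ (Mₙ (take a q)) ⟨
        Id · Mₙ (take a q)                ∎)
        where open ≈M-Reasoning

    irreducible⇒length≤ : ∀ q → Irreducible R q → length q ≤ 3 ℕ.* #matrices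
    irreducible⇒length≤ q (q-quid , ¬reducible , _) =
      ℕP.≮⇒≥ (λ long → ¬reducible (long⇒reducible q-quid long))

  irreducibles-finite : ∀ {p} (R : Carrier → Set p) → (∀ {x y} → x ≈ y → R x → R y) →
    (∀ {x y} → R x → R y → R (x + y)) → ∃[ L ] (∀ q → Irreducible R q → Any (q ≈L_) L)
  irreducibles-finite R R-resp R-+ =
    tuplesUpTo (3 ℕ.* #matrices) , λ q q-irr → ∈-tuplesUpTo q (irreducible⇒length≤ R-resp R-+ q q-irr)

  -- Deciding irreducibility

  _≟M_ : ∀ X Y → Dec (X ≈M Y)
  X ≟M Y = m11 X ≟ m11 Y Dec.×-dec m12 X ≟ m12 Y Dec.×-dec m21 X ≟ m21 Y Dec.×-dec m22 X ≟ m22 Y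

  _≟L_ : ∀ xs ys → Dec (xs ≈L ys)
  _≟L_ = PWP.decidable _≟_

  isλQuiddity? : ∀ q → Dec (IsλQuiddity Whole q)
  isλQuiddity? q = 1 ℕ.≤? length q Dec.×-dec yes (all-Whole q) Dec.×-dec (Mₙ q ≟M Id Dec.⊎-dec Mₙ q ≟M -Id)

  -- Rotations by k ≥ length q are trivial, so only k ≤ length q needs to be searched.
  _∼?_ : ∀ q X → Dec (q ∼ X)
  q ∼? X = Dec.map′ (λ (i , r) → toℕ i , r) bounded
    (FinP.any? (λ (i : Fin (suc (length q))) → rotates? (toℕ i)))
    where
    Rotates : ℕ → Set (c ⊔ ℓ)
    Rotates k = rotate k q ≈L X ⊎ rotate k (reverse q) ≈L X
    rotates? : ∀ k → Dec (Rotates k)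
    rotates? k = rotate k q ≟L X Dec.⊎-dec rotate k (reverse q) ≟L X
    rotate≡ : ∀ {k} xs → length xs ≤ length q → length q ≤ k → rotate (length q) xs ≡ rotate k xs
    rotate≡ xs xs≤q q≤k = P.trans (rotate-≥ xs xs≤q) (P.sym (rotate-≥ xs (ℕP.≤-trans xs≤q q≤k)))
    bounded : q ∼ X → ∃ λ (i : Fin (suc (length q))) → Rotates (toℕ i)
    bounded (k , r) with k ℕ.≤? length q
    ... | yes k≤q = Fin.fromℕ< (s≤s k≤q) , P.subst Rotates (P.sym (FinP.toℕ-fromℕ< (s≤s k≤q))) r
    ... | no  k≰q = Fin.fromℕ (length q) , P.subst Rotates (P.sym (FinP.toℕ-fromℕ (length q)))
          (Sum.map (≈L.trans (≈L.reflexive (rotate≡ q ℕP.≤-refl q≤k)))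
                   (≈L.trans (≈L.reflexive (rotate≡ (reverse q) (ℕP.≤-reflexive (LP.length-reverse q)) q≤k))) r)
      where
      q≤k : length q ≤ k
      q≤k = ℕP.<⇒≤ (ℕP.≰⇒> k≰q)

  ∃-bounded? : ∀ {p} {Pr : List Carrier → Set p} B → (∀ {xs ys} → xs ≈L ys → Pr xs → Pr ys) →
    (∀ xs → Dec (Pr xs)) → (∀ {xs} → Pr xs → length xs ≤ B) → Dec (∃ Pr)
  ∃-bounded? B Pr-resp Pr? bound with Any.any? Pr? (tuplesUpTo B)
  ... | yes some = yes (Any.satisfied some)
  ... | no  none = no λ (xs , pxs) → none (Any.map (λ xs≈ys → Pr-resp xs≈ys pxs) (∈-tuplesUpTo xs (bound pxs)))

  Splits : List Carrier → List Carrier → List Carrier → Set (c ⊔ ℓ)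
  Splits q as bs = IsλQuiddity Whole bs × All Whole as × 3 ≤ length as × 3 ≤ length bs × q ∼ (as ⊕ bs)

  splits? : ∀ q as bs → Dec (Splits q as bs)
  splits? q as bs = isλQuiddity? bs Dec.×-dec yes (all-Whole as) Dec.×-dec 3 ℕ.≤? length as
                      Dec.×-dec 3 ℕ.≤? length bs Dec.×-dec q ∼? (as ⊕ bs)

  Splits-resp : ∀ {q as as′ bs bs′} → as ≈L as′ → bs ≈L bs′ → Splits q as bs → Splits q as′ bs′
  Splits-resp as≈ bs≈ (bs-quid , _ , 3≤as , 3≤bs , q∼as⊕bs) =
    IsλQuiddity-resp (λ _ _ → tt) bs≈ bs-quid , all-Whole _ ,
    P.subst (3 ≤_) (PW.Pointwise-length as≈) 3≤as , P.subst (3 ≤_) (PW.Pointwise-length bs≈) 3≤bs ,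
    ∼-respʳ q∼as⊕bs (⊕-cong as≈ bs≈)

  Splits-length : ∀ {q as bs} → Splits q as bs → length as ≤ length q × length bs ≤ length q
  Splits-length {q} {as} {bs} (_ , _ , 3≤as , 3≤bs , q∼as⊕bs) =
    ℕP.+-cancelʳ-≤ 2 (length as) (length q)
      (P.subst (length as ℕ.+ 2 ≤_) as+bs≡ (ℕP.+-monoʳ-≤ (length as) 2≤bs)) ,
    ℕP.+-cancelʳ-≤ 2 (length bs) (length q)
      (P.subst (length bs ℕ.+ 2 ≤_) (P.trans (ℕP.+-comm (length bs) (length as)) as+bs≡)
        (ℕP.+-monoʳ-≤ (length bs) 2≤as))
    where
    2≤as : 2 ≤ length as
    2≤as = ℕP.≤-trans (ℕP.n≤1+n 2) 3≤as
    2≤bs : 2 ≤ length bs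
    2≤bs = ℕP.≤-trans (ℕP.n≤1+n 2) 3≤bs
    as+bs≡ : length as ℕ.+ length bs ≡ length q ℕ.+ 2
    as+bs≡ = P.trans (P.sym (length-⊕ as bs 2≤as 2≤bs)) (P.cong (ℕ._+ 2) (P.sym (length-∼ q∼as⊕bs)))

  reducible? : ∀ q → Dec (Reducible Whole q)
  reducible? q = isλQuiddity? q Dec.×-dec 3 ℕ.≤? length q Dec.×-dec
    ∃-bounded? (length q) (λ as≈ (bs , s) → bs , Splits-resp as≈ ≈L.refl s)
      (λ as → ∃-bounded? (length q) (Splits-resp ≈L.refl) (splits? q as) (λ s → proj₂ (Splits-length s)))
      (λ (_ , s) → proj₁ (Splits-length s))

  irreducible? : ∀ q → Dec (Irreducible Whole q)
  irreducible? q = isλQuiddity? q Dec.×-dec Dec.¬? (reducible? q) Dec.×-dec Dec.¬? (q ≟L (0# ∷ 0# ∷ []))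

  module _ (1≉0 : ¬ (1# ≈ 0#)) where
    open Families A 1≉0 using (0000-irreducible)

    maximal-irreducible : ∃[ q ] (Irreducible Whole q × ∀ q′ → Irreducible Whole q′ → length q′ ≤ length q)
    maximal-irreducible = q , q-irreducible , q-maximal
      where
      candidates : List (List Carrier)
      candidates = List.filter irreducible? (tuplesUpTo (3 ℕ.* #matrices))
      q : List Carrier
      q = argmax length (replicate 4 0#) candidates
      q-irreducible : Irreducible Whole q
      q-irreducible = argmax-all length 0000-irreducible (AllP.all-filter irreducible? (tuplesUpTo (3 ℕ.* #matrices)))
      q-maximal : ∀ q′ → Irreducible Whole q′ → length q′ ≤ length q
      q-maximal q′ q′-irr =
        Sum.[ ≤-candidate , (λ ¬irr → ⊥-elim (¬irr (Irreducible-resp (λ _ _ → tt) (AnyP.lookup-result q′∈) q′-irr))) ]′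
          (AnyP.filter⁺ irreducible? q′∈)
        where
        q′∈ : Any (q′ ≈L_) (tuplesUpTo (3 ℕ.* #matrices))
        q′∈ = ∈-tuplesUpTo q′ (irreducible⇒length≤ (λ _ _ → tt) (λ _ _ → tt) q′ q′-irr)
        ≤-candidate : Any (q′ ≈L_) candidates → length q′ ≤ length q
        ≤-candidate q′∈candidates =
          let y≤q , q′≈y = All.lookupAny (f[xs]≤f[argmax] {f = length} (replicate 4 0#) candidates) q′∈candidates
          in P.subst (_≤ length q) (P.sym (PW.Pointwise-length q′≈y)) y≤q

  -- Counting SL₂(A)

  ±1 : Fin 2 → Carrier
  ±1 Fin.zero    = 1#
  ±1 (Fin.suc _) = - 1#

  ±1≈±1 : ∀ σ → ±1 σ ≈±1
  ±1≈±1 Fin.zero    = inj₁ refl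
  ±1≈±1 (Fin.suc _) = inj₂ refl

  ±1-injective : ¬ (1# + 1# ≈ 0#) → ∀ {σ σ′} → ±1 σ ≈ ±1 σ′ → σ ≡ σ′
  ±1-injective 1+1≉0 {Fin.zero}         {Fin.zero}         _    = P.refl
  ±1-injective 1+1≉0 {Fin.suc Fin.zero} {Fin.suc Fin.zero} _    = P.refl
  ±1-injective 1+1≉0 {Fin.zero}         {Fin.suc Fin.zero} 1≈-1 =
    ⊥-elim (1+1≉0 (trans (+-congˡ 1≈-1) (-‿inverseʳ 1#)))
  ±1-injective 1+1≉0 {Fin.suc Fin.zero} {Fin.zero}         -1≈1 =
    ⊥-elim (1+1≉0 (trans (+-congˡ (sym -1≈1)) (-‿inverseʳ 1#)))

  module _ {s} (SL₂↔Fin : Inverse SL₂ (P.setoid (Fin s))) {q} (q-irreducible : Irreducible Whole q) where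
    open Inverse SL₂↔Fin using () renaming (to to index)

    SL₂-element : Fin (length q ℕ.∸ 2) → Fin 2 → Fin n → SL₂Carrier
    SL₂-element i σ u = (m11 X , m12 X , m21 X , m22 X) , det-X
      where
      X : Mat
      X = lower (±1 σ) (from u) · Mₙ (take (toℕ i) q)
      det-X : det X ≈ 1#
      det-X = trans (det-· (lower (±1 σ) (from u)) (Mₙ (take (toℕ i) q)))
        (trans (*-cong (det-lower (from u) (±1≈±1 σ)) (det-Mₙ (take (toℕ i) q))) (*-identityˡ 1#))

    code : Fin (length q ℕ.∸ 2) → Fin 2 → Fin n → Fin s
    code i σ u = index (SL₂-element i σ u)

    collision : ∀ i i′ σ σ′ u u′ → toℕ i ≤ toℕ i′ → code i σ u ≡ code i′ σ′ u′ →
      i ≡ i′ × ±1 σ ≈ ±1 σ′ × u ≡ u′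
    collision i i′ σ σ′ u u′ i≤i′ eq =
      let i≡ , σ≈ , t≈ = lower-prefix-injective q-irreducible i≤i′ (<∸2⇒+3≤ (length q) (FinP.toℕ<n i′))
                           (±1≈±1 σ) (±1≈±1 σ′) matrices≈
      in FinP.toℕ-injective i≡ , σ≈ , from-injective t≈
      where
      SL₂-elements≈ : Setoid._≈_ SL₂ (SL₂-element i σ u) (SL₂-element i′ σ′ u′)
      SL₂-elements≈ =
        Injection.injective (Inverse⇒Injection SL₂↔Fin) {SL₂-element i σ u} {SL₂-element i′ σ′ u′} eq
      matrices≈ : (lower (±1 σ) (from u) · Mₙ (take (toℕ i) q))
                    ≈M (lower (±1 σ′) (from u′) · Mₙ (take (toℕ i′) q))
      matrices≈ = SL₂-elements≈

    code-injective : ∀ i i′ σ σ′ u u′ → code i σ u ≡ code i′ σ′ u′ → i ≡ i′ × ±1 σ ≈ ±1 σ′ × u ≡ u′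
    code-injective i i′ σ σ′ u u′ eq =
      Sum.[ (λ i≤i′ → collision i i′ σ σ′ u u′ i≤i′ eq)
          , (λ i′≤i → flip (collision i′ i σ′ σ u′ u i′≤i (P.sym eq))) ]′
        (ℕP.≤-total (toℕ i) (toℕ i′))
      where
      flip : i′ ≡ i × ±1 σ′ ≈ ±1 σ × u′ ≡ u → i ≡ i′ × ±1 σ ≈ ±1 σ′ × u ≡ u′
      flip (i′≡ , σ′≈ , u′≡) = P.sym i′≡ , sym σ′≈ , P.sym u′≡

    length∸2*n≤ : (length q ℕ.∸ 2) ℕ.* n ≤ s
    length∸2*n≤ = injective₂⇒*≤ (λ i u → code i Fin.zero u)
      (λ {i} {u} {i′} {u′} eq →
        let i≡ , _ , u≡ = code-injective i i′ Fin.zero Fin.zero u u′ eq in i≡ , u≡)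

    length∸2*2n≤ : ¬ (1# + 1# ≈ 0#) → (length q ℕ.∸ 2) ℕ.* (2 ℕ.* n) ≤ s
    length∸2*2n≤ 1+1≉0 = injective₂⇒*≤ (λ i k → Product.uncurry (code i) (Fin.remQuot {2} n k))
      (λ {i} {k} {i′} {k′} eq →
        let σ , u   = Fin.remQuot {2} n k
            σ′ , u′ = Fin.remQuot {2} n k′
            i≡ , σ≈ , u≡ = code-injective i i′ σ σ′ u u′ eq
        in i≡ , remQuot-injective {2} n (P.cong₂ _,_ (±1-injective 1+1≉0 σ≈) u≡))

  module _ (1≉0 : ¬ (1# ≈ 0#)) where
    open Families A 1≉0 using (0000-irreducible; 4⊔characteristic≤; characteristic≢2⇒1+1≉0)

    maximal-size-bounds : ∀ s → Inverse SL₂ (P.setoid (Fin s)) →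
      ∃[ m ] (IsMaxIrreducibleSize Whole m × (∀ k → IsCharacteristic k →
        (k ≡ 2 → 4 ≤ m × m ℕ.* n ≤ s ℕ.+ 2 ℕ.* n) ×
        (k ≢ 2 → 4 ℕ.⊔ k ≤ m × m ℕ.* (2 ℕ.* n) ≤ s ℕ.+ 4 ℕ.* n)))
    maximal-size-bounds s SL₂↔Fin =
      let q , q-irr , q-max = maximal-irreducible 1≉0 in
      length q , ((q , q-irr , P.refl) , q-max) , λ k char →
        (λ _ → q-max _ 0000-irreducible , ∸2*≤⇒*≤ (length q) n s (length∸2*n≤ SL₂↔Fin q-irr)) ,
        (λ k≢2 → 4⊔characteristic≤ q-max char ,
          P.subst (λ t → length q ℕ.* (2 ℕ.* n) ≤ s ℕ.+ t) (P.sym (ℕP.*-assoc 2 2 n))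
            (∸2*≤⇒*≤ (length q) (2 ℕ.* n) s
              (length∸2*2n≤ SL₂↔Fin q-irr (characteristic≢2⇒1+1≉0 char k≢2))))

open import Data.Nat using (_+_; _*_; _⊔_)
open import Relation.Binary.PropositionalEquality using (setoid)

theorem1p1 : ∀ {c ℓ p : Level} (A : CommutativeRing c ℓ) (n : ℕ) →
    Inverse (CommutativeRing.setoid A) (setoid (Fin n)) →
    ¬ (CommutativeRing._≈_ A (CommutativeRing.1# A) (CommutativeRing.0# A)) →
    (∀ (R : CommutativeRing.Carrier A → Set p) →
      (∀ {x y} → CommutativeRing._≈_ A x y → R x → R y) →
      (∀ {x y} → R x → R y → R (CommutativeRing._+_ A x y)) →
      ∃[ L ] (∀ q → Q.Irreducible A R q → Any (Q._≈L_ A q) L))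
    ×
    (∀ (s : ℕ) → Inverse (Q.SL₂ A) (setoid (Fin s)) →
      ∃[ m ] (Q.IsMaxIrreducibleSize A (Q.Whole A) m ×
        (∀ k → Q.IsCharacteristic A k →
          (k ≡ 2 → 4 ≤ m × m * n ≤ s + 2 * n) ×
          (k ≢ 2 → (4 ⊔ k) ≤ m × m * (2 * n) ≤ s + 4 * n))))
theorem1p1 A n A↔Fin 1≉0 = irreducibles-finite , maximal-size-bounds 1≉0
  where open FiniteRing A A↔Fin
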